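{- Let $G$ be a connected graph of order $n\geq 4$ with $\dim(G)=n-2$, and let $\ell\geq 1$ be an integer. Then $D(G)=n-\ell$ if and only if $G$ is one of the following: (a) $K_{\ell+1,\ell+1}$; (b) $K_{t,\ell}$ with $t\geq \ell+1$; (c) $K_\ell+\overline{K_t}$ with $t\geq \ell$; (d) $K_t+\overline{K_\ell}$ with $t\geq\ell\geq 2$; (e) $K_{\ell-1}+(K_t\cup K_1)$ with $t\geq\max\{2,\ell-1\}$; (f) $K_t+(K_{\ell-1}\cup K_1)$ with $t\geq \max\{2,\ell-1\}$.
   Context: $\dim(G)$ is the metric dimension (minimum size of a set $S\subseteq V(G)$ such that every two distinct vertices have different distances to some vertex of $S$). $D(G)$ is the distinguishing number (minimum number of colours in a not necessarily proper vertex colouring preserved by no non-trivial automorphism). $K_r$ is the complete graph, $\overline{K_r}$ the edgeless graph on $r$ vertices, $K_{s,t}$ the complete bipartite graph, $G\cup H$ the disjoint union, and $G+H$ the join (disjoint union plus all edges between $G$ and $H$). Graphs are considered up to isomorphism; $K_0$ denotes the empty graph. -}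

module Defs where

open import Data.Nat using (ℕ; zero; suc; _+_; _∸_; _≤_; _<_)
open import Data.Fin using (Fin; splitAt)
open import Data.Fin.Properties using () renaming (_≟_ to _≟ᶠ_)
open import Data.Fin.Subset using (Subset; _∈_; ∣_∣)
open import Data.Bool using (Bool; true; false; not)
open import Data.Sum using (_⊎_; inj₁; inj₂)
open import Data.Product using (Σ; ∃; ∃-syntax; _×_; _,_)
open import Relation.Nullary using (¬_)
open import Relation.Nullary.Decidable using (⌊_⌋)
open import Relation.Binary.PropositionalEquality using (_≡_; _≢_)
open import Function.Bundles using (_↔_; Inverse)

Adj : ℕ → Set
Adj n = Fin n → Fin n → Bool

IsSimple : ∀ {n} → Adj n → Set
IsSimple {n} G = (∀ u v → G u v ≡ G v u) × (∀ v → G v v ≡ false)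

data Walk {n} (G : Adj n) : Fin n → Fin n → ℕ → Set where
  here : ∀ {v} → Walk G v v 0
  step : ∀ {u w v k} → G u w ≡ true → Walk G w v k → Walk G u v (suc k)

Connected : ∀ {n} → Adj n → Set
Connected {n} G = ∀ (u v : Fin n) → ∃[ k ] Walk G u v k

Dist : ∀ {n} → Adj n → Fin n → Fin n → ℕ → Set
Dist G u v d = Walk G u v d × (∀ k → k < d → ¬ Walk G u v k)

Resolving : ∀ {n} → Adj n → Subset n → Set
Resolving {n} G S = ∀ (x y : Fin n) → x ≢ y →
  ∃[ s ] (s ∈ S × ∃[ d₁ ] ∃[ d₂ ] (Dist G s x d₁ × Dist G s y d₂ × d₁ ≢ d₂))

MetricDim : ∀ {n} → Adj n → ℕ → Set
MetricDim {n} G k =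
  (∃[ S ] (Resolving G S × ∣ S ∣ ≡ k)) × (∀ (S : Subset n) → Resolving G S → k ≤ ∣ S ∣)

Aut : ∀ {n} → Adj n → Set
Aut {n} G = Σ (Fin n ↔ Fin n) λ f →
  ∀ u v → G u v ≡ G (Inverse.to f u) (Inverse.to f v)

Distinguishing : ∀ {n k} → Adj n → (Fin n → Fin k) → Set
Distinguishing {n} G c = ∀ (φ : Aut G) →
  (∀ v → c (Inverse.to (Data.Product.proj₁ φ) v) ≡ c v) →
  ∀ v → Inverse.to (Data.Product.proj₁ φ) v ≡ v

DistNum : ∀ {n} → Adj n → ℕ → Set
DistNum {n} G m =
  (∃[ c ] Distinguishing {n} {m} G c) ×
  (∀ k → k < m → ∀ (c : Fin n → Fin k) → ¬ Distinguishing G c)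

_≅_ : ∀ {n m} → Adj n → Adj m → Set
_≅_ {n} {m} G H = Σ (Fin n ↔ Fin m) λ f →
  ∀ u v → G u v ≡ H (Inverse.to f u) (Inverse.to f v)

K : (r : ℕ) → Adj r
K r u v = not ⌊ u ≟ᶠ v ⌋

Kbar : (r : ℕ) → Adj r
Kbar r _ _ = false

combine : ∀ {a b} → Bool → Adj a → Adj b → Adj (a + b)
combine {a} cross G H u v with splitAt a u | splitAt a v
... | inj₁ x | inj₁ y = G x y
... | inj₂ x | inj₂ y = H x y
... | inj₁ _ | inj₂ _ = cross
... | inj₂ _ | inj₁ _ = cross

_∪ᴳ_ : ∀ {a b} → Adj a → Adj b → Adj (a + b)
G ∪ᴳ H = combine false G H

_+ᴳ_ : ∀ {a b} → Adj a → Adj b → Adj (a + b)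
G +ᴳ H = combine true G H

Kbip : (s t : ℕ) → Adj (s + t)
Kbip s t = Kbar s +ᴳ Kbar t

Family : ℕ → ∀ {n} → Adj n → Set
Family ℓ G =
    (G ≅ Kbip (suc ℓ) (suc ℓ))
  ⊎ (∃[ t ] (suc ℓ ≤ t × G ≅ Kbip t ℓ))
  ⊎ (∃[ t ] (ℓ ≤ t × G ≅ (K ℓ +ᴳ Kbar t)))
  ⊎ (∃[ t ] (ℓ ≤ t × 2 ≤ ℓ × G ≅ (K t +ᴳ Kbar ℓ)))
  ⊎ (∃[ t ] (2 ≤ t × ℓ ∸ 1 ≤ t × G ≅ (K (ℓ ∸ 1) +ᴳ (K t ∪ᴳ K 1))))
  ⊎ (∃[ t ] (2 ≤ t × ℓ ∸ 1 ≤ t × G ≅ (K t +ᴳ (K (ℓ ∸ 1) ∪ᴳ K 1))))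

-- Two twins (vertices with the same neighbours apart from each other) can be swapped by an
-- automorphism, so a distinguishing colouring gives them different colours: the largest set of
-- pairwise twins bounds D(G) from below. If dim(G) = n − 2 then G has diameter two and at most three
-- twin classes, since otherwise all vertices but three suitable ones would form a resolving set of size
-- n − 3; a short analysis of how the classes are joined leaves exactly K_{a,b}, K_a + \overline{K_b} and
-- K_a + (K_b ∪ K_1) with b ≥ 2. Explicit colourings show that D is the largest twin class (a + 1 for
-- K_{a,a}), and solving n − ℓ = D in each case gives the six families.

module Submission where

open import Defs
open import Data.Nat using (ℕ; zero; suc; _+_; _∸_; _≤_; _<_; _⊔_; z≤n; s≤s)
open import Data.Nat.Properties
  using ( module ≤-Reasoning; suc-injective; <-cmp; ≤-refl; ≤-trans; ≤-reflexive; <⇒≤; <⇒≱; n≤1+n; 1+n≢n; 1+n≰n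
        ; m≤n⇒m<n∨m≡n; m≤m⊔n; m≤n⊔m; ⊔-sel; m≤n⇒m⊔n≡n; m≥n⇒m⊔n≡m; m∸[m∸n]≡n
        ; +-comm; +-suc; +-assoc; +-cancelˡ-≡; m+n∸n≡m; m∸n+n≡m; ≤-total; _≤?_; ≰⇒>; m≤n⇒m∸n≡0 )
open import Data.Fin using (Fin; toℕ; splitAt; join; _↑ˡ_; _↑ʳ_; inject≤; punchOut) renaming (zero to 0F; suc to 1+)
open import Data.Fin.Properties
  using ( _≟_; any?; all?; ¬∀⟶∃¬; toℕ-injective; toℕ-inject≤; inject≤-injective; <⇒notInjective; injective⇒≤
        ; punchOut-injective; ↑ˡ-injective; ↑ʳ-injective; splitAt-↑ˡ; splitAt-↑ʳ; splitAt⁻¹-↑ˡ; splitAt⁻¹-↑ʳ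
        ; splitAt-join; join-splitAt )
  renaming (suc-injective to 1+-injective)
open import Data.Fin.Permutation using (transpose; ↔⇒≡)
import Data.Fin.Permutation.Components as PC
open import Data.Fin.Subset using (Subset; _∈_; ∣_∣; ∁; ⁅_⁆; _-_)
open import Data.Fin.Subset.Properties
  using (x∉p⇒x∈∁p; x∈∁p⇒x∉p; x∈p∧x≢y⇒x∈p-y; x∈p⇒∣p-x∣<∣p∣; ∣∁p∣≡n∸∣p∣; ∣⁅x⁆∣≡1; x∈⁅y⁆⇒x≡y)
open import Data.Vec.Base using (_∷_; here; there)
open import Data.Bool using (Bool; true; false)
open import Data.Bool.Properties using (¬-not) renaming (_≟_ to _≟ᵇ_)
open import Data.Unit using (⊤; tt)
open import Data.Empty using (⊥; ⊥-elim)
open import Data.Sum using (_⊎_; inj₁; inj₂; [_,_]′; swap; map₁; map₂)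
open import Data.Sum.Properties using (swap-involutive; inj₁-injective; inj₂-injective)
open import Data.Product using (∃; ∃₂; _×_; _,_; proj₁; proj₂)
open import Relation.Nullary using (¬_; Dec; does; yes; no; contradiction; ¬?; _×-dec_; _→-dec_)
open import Relation.Nullary.Decidable using (dec-false; decidable-stable)
open import Relation.Unary using (Decidable)
open import Relation.Binary.Definitions using (tri<; tri≈; tri>)
open import Relation.Binary.PropositionalEquality
open import Function.Base using (_∘_)
open import Function.Bundles using (_↔_; Inverse; Injection; mk↔ₛ′; _⇔_; mk⇔)
open import Function.Definitions using (Injective)
open import Function.Properties.Inverse using (↔-sym; ↔-trans; Inverse⇒Injection)

open Inverse using (to; from; strictlyInverseˡ; strictlyInverseʳ)

infixr 5 _⨾_
_⨾_ : ∀ {A : Set} {x y z : A} → x ≡ y → y ≡ z → x ≡ z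
_⨾_ = trans

another : ∀ {b} → 2 ≤ b → (j : Fin b) → ∃ λ j′ → j′ ≢ j
another (s≤s (s≤s _)) 0F = 1+ 0F , λ ()
another (s≤s (s≤s _)) (1+ j) = 0F , λ ()

inhabitant : ∀ {b} → 1 ≤ b → Fin b
inhabitant (s≤s _) = 0F

true≢false : true ≢ false
true≢false ()

differs-from-true : ∀ {a b : Bool} → a ≢ b → a ≡ true → b ≡ false
differs-from-true {b = false} _ _ = refl
differs-from-true {b = true} a≢b refl = contradiction refl a≢b

differs-from-false : ∀ {a b : Bool} → a ≢ b → a ≡ false → b ≡ true
differs-from-false {b = true} _ _ = refl
differs-from-false {b = false} a≢b refl = contradiction refl a≢b

does-true : ∀ {A : Set} (a? : Dec A) → does a? ≡ true → A
does-true (yes a) _ = a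

does-false : ∀ {A : Set} (a? : Dec A) → does a? ≡ false → ¬ A
does-false (no ¬a) _ = ¬a

-- Isomorphisms, automorphisms and twins

to-injective : ∀ {n m} (f : Fin n ↔ Fin m) → Injective _≡_ _≡_ (to f)
to-injective f = Injection.injective (Inverse⇒Injection f)

≅-sym : ∀ {n m} {G : Adj n} {H : Adj m} → G ≅ H → H ≅ G
≅-sym {H = H} (f , iso) = ↔-sym f , λ u v →
  sym (cong₂ H (strictlyInverseˡ f u) (strictlyInverseˡ f v)) ⨾ sym (iso (from f u) (from f v))

≅-trans : ∀ {n m k} {G : Adj n} {H : Adj m} {J : Adj k} → G ≅ H → H ≅ J → G ≅ J
≅-trans (f , isoᶠ) (g , isoᵍ) = ↔-trans f g , λ u v → isoᶠ u v ⨾ isoᵍ _ _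

≅⇒≡ : ∀ {n m} {G : Adj n} {H : Adj m} → G ≅ H → n ≡ m
≅⇒≡ (f , _) = ↔⇒≡ f

-- An isomorphism f : G ≅ H conjugates automorphisms of G into automorphisms of H.
Distinguishing-transport : ∀ {n m k} {G : Adj n} {H : Adj m} (i : G ≅ H) (c : Fin m → Fin k) →
  Distinguishing H c → Distinguishing G (λ v → c (to (proj₁ i) v))
Distinguishing-transport {H = H} (f , iso) c dist (φ , autφ) preserves v =
  to-injective f (cong (λ w → to f (to φ w)) (sym (strictlyInverseʳ f v)) ⨾ dist (ψ , autψ) preservesψ (to f v))
  where
  ψ : Fin _ ↔ Fin _
  ψ = ↔-trans (↔-sym f) (↔-trans φ f)
  autψ : ∀ u w → H u w ≡ H (to ψ u) (to ψ w)
  autψ u w = sym (cong₂ H (strictlyInverseˡ f u) (strictlyInverseˡ f w))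
    ⨾ sym (iso (from f u) (from f w)) ⨾ autφ (from f u) (from f w) ⨾ iso _ _
  preservesψ : ∀ w → c (to ψ w) ≡ c w
  preservesψ w = preserves (from f w) ⨾ cong c (strictlyInverseˡ f w)

DistNum-transport : ∀ {n m k} {G : Adj n} {H : Adj m} → G ≅ H → DistNum H k → DistNum G k
DistNum-transport i ((c , dist) , minimal) =
  (_ , Distinguishing-transport i c dist) ,
  λ j j<k c′ dist′ → minimal j j<k _ (Distinguishing-transport (≅-sym i) c′ dist′)

DistNum-functional : ∀ {n} {G : Adj n} {m m′} → DistNum G m → DistNum G m′ → m ≡ m′
DistNum-functional {m = m} {m′} ((c , dist) , minimal) ((c′ , dist′) , minimal′) with <-cmp m m′
... | tri< m<m′ _ _ = ⊥-elim (minimal′ m m<m′ c dist)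
... | tri≈ _ m≡m′ _ = m≡m′
... | tri> _ _ m′<m = ⊥-elim (minimal m′ m′<m c′ dist′)

Twin : ∀ {n} → Adj n → Fin n → Fin n → Set
Twin G x y = ∀ w → w ≢ x → w ≢ y → G w x ≡ G w y

data TransposeView {n} (i j k : Fin n) : Fin n → Set where
  at-i  : k ≡ i → TransposeView i j k j
  at-j  : k ≢ i → k ≡ j → TransposeView i j k i
  other : k ≢ i → k ≢ j → TransposeView i j k k

transpose-view : ∀ {n} (i j k : Fin n) → TransposeView i j k (PC.transpose i j k)
transpose-view i j k with k ≟ i
... | yes k≡i = at-i k≡i
... | no k≢i with k ≟ j
...   | yes k≡j = at-j k≢i k≡j
...   | no k≢j = other k≢i k≢j

module _ {n} {G : Adj n} (simple : IsSimple G) where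

  private
    sym-G = proj₁ simple
    irrefl-G = proj₂ simple

  transpose-twins-aut : ∀ {x y} → Twin G x y →
    ∀ u v → G u v ≡ G (PC.transpose x y u) (PC.transpose x y v)
  transpose-twins-aut {x} {y} twin u v with PC.transpose x y u | transpose-view x y u
                                          | PC.transpose x y v | transpose-view x y v
  ... | _ | at-i refl     | _ | at-i refl     = irrefl-G u ⨾ sym (irrefl-G y)
  ... | _ | at-i refl     | _ | at-j _ refl   = sym-G u v
  ... | _ | at-i refl     | _ | other v≢x v≢y = sym-G u v ⨾ twin v v≢x v≢y ⨾ sym-G v y
  ... | _ | at-j _ refl   | _ | at-i refl     = sym-G u v
  ... | _ | at-j _ refl   | _ | at-j _ refl   = irrefl-G u ⨾ sym (irrefl-G x)
  ... | _ | at-j _ refl   | _ | other v≢x v≢y = sym-G u v ⨾ sym (twin v v≢x v≢y) ⨾ sym-G v x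
  ... | _ | other u≢x u≢y | _ | at-i refl     = twin u u≢x u≢y
  ... | _ | other u≢x u≢y | _ | at-j _ refl   = sym (twin u u≢x u≢y)
  ... | _ | other _ _     | _ | other _ _     = refl

  -- Swapping two twins of the same colour is a colour-preserving automorphism.
  Distinguishing⇒twins-coloured-apart : ∀ {k} (c : Fin n → Fin k) → Distinguishing G c →
    ∀ {x y} → Twin G x y → x ≢ y → c x ≢ c y
  Distinguishing⇒twins-coloured-apart c dist {x} {y} twin x≢y cx≡cy =
    x≢y (sym y↦x ⨾ dist (transpose x y , transpose-twins-aut twin) preserves y)
    where
    y↦x : PC.transpose x y y ≡ x
    y↦x with PC.transpose x y y | transpose-view x y y
    ... | _ | at-i y≡x = y≡x
    ... | _ | at-j _ _ = refl
    ... | _ | other _ y≢y = contradiction refl y≢y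
    preserves : ∀ v → c (PC.transpose x y v) ≡ c v
    preserves v with PC.transpose x y v | transpose-view x y v
    ... | _ | at-i refl   = sym cx≡cy
    ... | _ | at-j _ refl = cx≡cy
    ... | _ | other _ _   = refl

  Distinguishing⇒twins-injective : ∀ {a k} (c : Fin n → Fin k) → Distinguishing G c →
    (e : Fin a → Fin n) → Injective _≡_ _≡_ e → (∀ i j → Twin G (e i) (e j)) →
    Injective _≡_ _≡_ (λ i → c (e i))
  Distinguishing⇒twins-injective c dist e e-injective twins {i} {j} same with i ≟ j
  ... | yes i≡j = i≡j
  ... | no i≢j = contradiction same
                   (Distinguishing⇒twins-coloured-apart c dist (twins i j) (λ eᵢ≡eⱼ → i≢j (e-injective eᵢ≡eⱼ)))

  twins-bound-colours : ∀ {a} (e : Fin a → Fin n) → Injective _≡_ _≡_ e →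
    (∀ i j → Twin G (e i) (e j)) → ∀ k → k < a → (c : Fin n → Fin k) → ¬ Distinguishing G c
  twins-bound-colours e e-injective twins k k<a c dist =
    <⇒notInjective k<a (Distinguishing⇒twins-injective c dist e e-injective twins)

AlikeOutside : ∀ {n} → Adj n → Fin n → Fin n → Fin n → Set
AlikeOutside G x y z = ∀ w → w ≢ x → w ≢ y → w ≢ z → G w x ≡ G w y

module TwinProperties {n} {G : Adj n} (simple : IsSimple G) where

  private
    sym-G = proj₁ simple

  Twin-refl : ∀ {x} → Twin G x x
  Twin-refl _ _ _ = refl

  Twin-sym : ∀ {x y} → Twin G x y → Twin G y x
  Twin-sym twin w w≢y w≢x = sym (twin w w≢x w≢y)

  Twin-adjacency : ∀ {x y v} → Twin G x y → v ≢ x → v ≢ y → G x v ≡ G y v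
  Twin-adjacency {x} {y} {v} twin v≢x v≢y = sym-G x v ⨾ twin v v≢x v≢y ⨾ sym-G v y

  Twin-trans : ∀ {x y z} → Twin G x y → Twin G y z → Twin G x z
  Twin-trans {x} {y} {z} xy yz w w≢x w≢z with w ≟ y
  ... | no w≢y = xy w w≢x w≢y ⨾ yz w w≢y w≢z
  ... | yes refl with x ≟ z
  ...   | yes refl = refl
  ...   | no x≢z = sym-G w x ⨾ yz x (≢-sym w≢x) x≢z ⨾ sym-G x z ⨾ xy z (≢-sym x≢z) (≢-sym w≢z) ⨾ sym-G z w

  ¬Twin⇒≢ : ∀ {x y} → ¬ Twin G x y → x ≢ y
  ¬Twin⇒≢ ¬twin refl = ¬twin Twin-refl

  twin? : ∀ x y → Dec (Twin G x y)
  twin? x y = all? (λ w → ¬? (w ≟ x) →-dec ¬? (w ≟ y) →-dec (G w x ≟ᵇ G w y))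

  alikeOutside? : ∀ x y z → Dec (AlikeOutside G x y z)
  alikeOutside? x y z = all? (λ w → ¬? (w ≟ x) →-dec ¬? (w ≟ y) →-dec ¬? (w ≟ z) →-dec (G w x ≟ᵇ G w y))

  ¬AlikeOutside⇒separator : ∀ {x y z} → ¬ AlikeOutside G x y z →
    ∃ λ w → w ≢ x × w ≢ y × w ≢ z × G w x ≢ G w y
  ¬AlikeOutside⇒separator {x} {y} {z} ¬alike
    with ¬∀⟶∃¬ n _ (λ w → ¬? (w ≟ x) →-dec ¬? (w ≟ y) →-dec ¬? (w ≟ z) →-dec (G w x ≟ᵇ G w y)) ¬alike
  ... | w , ¬alikeʷ with w ≟ x | w ≟ y | w ≟ z | G w x ≟ᵇ G w y
  ...   | yes w≡x | _ | _ | _ = contradiction (λ w≢x _ _ → contradiction w≡x w≢x) ¬alikeʷ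
  ...   | no _ | yes w≡y | _ | _ = contradiction (λ _ w≢y _ → contradiction w≡y w≢y) ¬alikeʷ
  ...   | no _ | no _ | yes w≡z | _ = contradiction (λ _ _ w≢z → contradiction w≡z w≢z) ¬alikeʷ
  ...   | no _ | no _ | no _ | yes same = contradiction (λ _ _ _ → same) ¬alikeʷ
  ...   | no w≢x | no w≢y | no w≢z | no differ = w , w≢x , w≢y , w≢z , differ

  ¬Twin⇒separator : ∀ {x y} → ¬ Twin G x y → ∃ λ w → w ≢ x × w ≢ y × G w x ≢ G w y
  ¬Twin⇒separator ¬twin with ¬AlikeOutside⇒separator (λ alike → ¬twin (λ w w≢x w≢y → alike w w≢x w≢y w≢x))
  ... | w , w≢x , w≢y , _ , differ = w , w≢x , w≢y , differ

-- Joins and unions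

data Side (a b : ℕ) : Fin (a + b) → Set where
  left  : (i : Fin a) → Side a b (i ↑ˡ b)
  right : (j : Fin b) → Side a b (a ↑ʳ j)

side : ∀ a b (u : Fin (a + b)) → Side a b u
side a b u with splitAt a u in eq
... | inj₁ i = subst (Side a b) (splitAt⁻¹-↑ˡ eq) (left i)
... | inj₂ j = subst (Side a b) (splitAt⁻¹-↑ʳ eq) (right j)

↑ˡ≢↑ʳ : ∀ {a b} (i : Fin a) (j : Fin b) → i ↑ˡ b ≢ a ↑ʳ j
↑ˡ≢↑ʳ {a} {b} i j eq with sym (splitAt-↑ˡ a i b) ⨾ cong (splitAt a) eq ⨾ splitAt-↑ʳ a b j
... | ()

module _ {a b : ℕ} (cross : Bool) (G : Adj a) (H : Adj b) where

  combine-ˡˡ : ∀ i j → combine cross G H (i ↑ˡ b) (j ↑ˡ b) ≡ G i j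
  combine-ˡˡ i j rewrite splitAt-↑ˡ a i b | splitAt-↑ˡ a j b = refl

  combine-ˡʳ : ∀ i j → combine cross G H (i ↑ˡ b) (a ↑ʳ j) ≡ cross
  combine-ˡʳ i j rewrite splitAt-↑ˡ a i b | splitAt-↑ʳ a b j = refl

  combine-ʳˡ : ∀ j i → combine cross G H (a ↑ʳ j) (i ↑ˡ b) ≡ cross
  combine-ʳˡ j i rewrite splitAt-↑ˡ a i b | splitAt-↑ʳ a b j = refl

  combine-ʳʳ : ∀ i j → combine cross G H (a ↑ʳ i) (a ↑ʳ j) ≡ H i j
  combine-ʳʳ i j rewrite splitAt-↑ʳ a b i | splitAt-↑ʳ a b j = refl

  combine-simple : IsSimple G → IsSimple H → IsSimple (combine cross G H)
  combine-simple (sym-G , irrefl-G) (sym-H , irrefl-H) = symmetric , irreflexive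
    where
    symmetric : ∀ u v → combine cross G H u v ≡ combine cross G H v u
    symmetric u v with side a b u | side a b v
    ... | left i  | left j  = combine-ˡˡ i j ⨾ sym-G i j ⨾ sym (combine-ˡˡ j i)
    ... | left i  | right j = combine-ˡʳ i j ⨾ sym (combine-ʳˡ j i)
    ... | right i | left j  = combine-ʳˡ i j ⨾ sym (combine-ˡʳ j i)
    ... | right i | right j = combine-ʳʳ i j ⨾ sym-H i j ⨾ sym (combine-ʳʳ j i)
    irreflexive : ∀ u → combine cross G H u u ≡ false
    irreflexive u with side a b u
    ... | left i  = combine-ˡˡ i i ⨾ irrefl-G i
    ... | right j = combine-ʳʳ j j ⨾ irrefl-H j

  twin-↑ˡ : ∀ {i j} → Twin G i j → Twin (combine cross G H) (i ↑ˡ b) (j ↑ˡ b)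
  twin-↑ˡ {i} {j} twin w w≢i w≢j with side a b w
  ... | left k  = combine-ˡˡ k i ⨾ twin k (w≢i ∘ cong (_↑ˡ b)) (w≢j ∘ cong (_↑ˡ b)) ⨾ sym (combine-ˡˡ k j)
  ... | right k = combine-ʳˡ k i ⨾ sym (combine-ʳˡ k j)

  twin-↑ʳ : ∀ {i j} → Twin H i j → Twin (combine cross G H) (a ↑ʳ i) (a ↑ʳ j)
  twin-↑ʳ {i} {j} twin w w≢i w≢j with side a b w
  ... | left k  = combine-ˡʳ k i ⨾ sym (combine-ˡʳ k j)
  ... | right k = combine-ʳʳ k i ⨾ twin k (w≢i ∘ cong (a ↑ʳ_)) (w≢j ∘ cong (a ↑ʳ_)) ⨾ sym (combine-ʳʳ k j)

K-irrefl : ∀ {r} (i : Fin r) → K r i i ≡ false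
K-irrefl i with i ≟ i
... | yes _ = refl
... | no i≢i = contradiction refl i≢i

K-adjacent : ∀ {r} {i j : Fin r} → i ≢ j → K r i j ≡ true
K-adjacent {i = i} {j} i≢j with i ≟ j
... | yes i≡j = contradiction i≡j i≢j
... | no _ = refl

K-simple : ∀ r → IsSimple (K r)
K-simple r = symmetric , K-irrefl
  where
  symmetric : ∀ u v → K r u v ≡ K r v u
  symmetric u v with u ≟ v | v ≟ u
  ... | yes _   | yes _   = refl
  ... | no _    | no _    = refl
  ... | yes u≡v | no v≢u  = contradiction (sym u≡v) v≢u
  ... | no u≢v  | yes v≡u = contradiction (sym v≡u) u≢v

Kbar-simple : ∀ r → IsSimple (Kbar r)
Kbar-simple r = (λ _ _ → refl) , (λ _ → refl)

K-twins : ∀ {r} (i j : Fin r) → Twin (K r) i j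
K-twins i j k k≢i k≢j = K-adjacent k≢i ⨾ sym (K-adjacent k≢j)

Kbar-twins : ∀ {r} (i j : Fin r) → Twin (Kbar r) i j
Kbar-twins i j k _ _ = refl

-- Distinguishing numbers of the model graphs

bySide : ∀ {a b} {A : Set} → (Fin a → A) → (Fin b → A) → Fin (a + b) → A
bySide {a} f g u = [ f , g ]′ (splitAt a u)

bySide-↑ˡ : ∀ {a b} {A : Set} (f : Fin a → A) (g : Fin b → A) i → bySide f g (i ↑ˡ b) ≡ f i
bySide-↑ˡ {a} {b} f g i rewrite splitAt-↑ˡ a i b = refl

bySide-↑ʳ : ∀ {a b} {A : Set} (f : Fin a → A) (g : Fin b → A) j → bySide {a} f g (a ↑ʳ j) ≡ g j
bySide-↑ʳ {a} {b} f g j rewrite splitAt-↑ʳ a b j = refl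

Preserves : ∀ {n k} {G : Adj n} → Aut G → (Fin n → Fin k) → Set
Preserves φ c = ∀ v → c (to (proj₁ φ) v) ≡ c v

Distinguishing-by-labels : ∀ {n k} {L : Set} {G : Adj n} (c : Fin n → Fin k) (κ : Fin n → L) →
  (∀ (φ : Aut G) → Preserves φ c → ∀ v → κ (to (proj₁ φ) v) ≡ κ v) →
  (∀ {u v} → c u ≡ c v → κ u ≡ κ v → u ≡ v) → Distinguishing G c
Distinguishing-by-labels c κ stable determines φ preserves v =
  determines (preserves v) (stable φ preserves v)

Universal : ∀ {n} → Adj n → Fin n → Set
Universal G u = ∀ v → v ≢ u → G u v ≡ true

HasNonUniversalNeighbour : ∀ {n} → Adj n → Fin n → Set
HasNonUniversalNeighbour G u = ∃ λ v → ¬ Universal G v × G u v ≡ true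

Invariant : ∀ {n} → Adj n → (Fin n → Set) → Set
Invariant G P = ∀ (φ : Aut G) u → (P u → P (to (proj₁ φ) u)) × (P (to (proj₁ φ) u) → P u)

Universal-invariant : ∀ {n} {G : Adj n} → Invariant G (Universal G)
Universal-invariant {G = G} (f , aut) u = forward , backward
  where
  forward : Universal G u → Universal G (to f u)
  forward univ v v≢fu =
    cong (G (to f u)) (sym (strictlyInverseˡ f v)) ⨾ sym (aut u (from f v))
    ⨾ univ (from f v) (λ f⁻¹v≡u → v≢fu (sym (strictlyInverseˡ f v) ⨾ cong (to f) f⁻¹v≡u))
  backward : Universal G (to f u) → Universal G u
  backward univ v v≢u = aut u v ⨾ univ (to f v) (λ fv≡fu → v≢u (to-injective f fv≡fu))

HasNonUniversalNeighbour-invariant : ∀ {n} {G : Adj n} → Invariant G (HasNonUniversalNeighbour G)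
HasNonUniversalNeighbour-invariant {G = G} φ@(f , aut) u = forward , backward
  where
  forward : HasNonUniversalNeighbour G u → HasNonUniversalNeighbour G (to f u)
  forward (v , ¬univ , uv) =
    to f v , (λ univ → ¬univ (proj₂ (Universal-invariant φ v) univ)) , sym (aut u v) ⨾ uv
  backward : HasNonUniversalNeighbour G (to f u) → HasNonUniversalNeighbour G u
  backward (v , ¬univ , fuv) =
    from f v ,
    (λ univ → ¬univ (subst (Universal G) (strictlyInverseˡ f v) (proj₁ (Universal-invariant φ (from f v)) univ))) ,
    aut u (from f v) ⨾ cong (G (to f u)) (strictlyInverseˡ f v) ⨾ fuv

label-stable : ∀ {n} {G : Adj n} {P : Fin n → Set} (κ : Fin n → Bool) → Invariant G P →
  (∀ u → κ u ≡ true → P u) → (∀ u → κ u ≡ false → ¬ P u) →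
  ∀ (φ : Aut G) u → κ (to (proj₁ φ) u) ≡ κ u
label-stable κ invariant true⇒P false⇒¬P φ u with κ u in κu | κ (to (proj₁ φ) u) in κφu
... | true  | true  = refl
... | false | false = refl
... | true  | false = contradiction (proj₁ (invariant φ u) (true⇒P u κu)) (false⇒¬P _ κφu)
... | false | true  = contradiction (proj₂ (invariant φ u) (true⇒P _ κφu)) (false⇒¬P u κu)

onLeft : ∀ a {b} → Fin (a + b) → Bool
onLeft a = bySide {a} (λ _ → true) (λ _ → false)

onLeft-↑ˡ : ∀ {a b} (i : Fin a) → onLeft a {b} (i ↑ˡ b) ≡ true
onLeft-↑ˡ i = bySide-↑ˡ (λ _ → true) (λ _ → false) i

onLeft-↑ʳ : ∀ {a b} (j : Fin b) → onLeft a {b} (a ↑ʳ j) ≡ false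
onLeft-↑ʳ {a} j = bySide-↑ʳ {a} (λ _ → true) (λ _ → false) j

module Kbip-rigid {a b m : ℕ} (a<m : suc a ≤ m) (b<m : suc b ≤ m) where

  colouring : Fin (suc a + b) → Fin m
  colouring = bySide (λ i → inject≤ i a<m) (λ j → inject≤ (1+ j) b<m)

  private
    G : Adj (suc a + b)
    G = Kbip (suc a) b
    x* : Fin (suc a + b)
    x* = 0F ↑ˡ b

    colour-left : ∀ i → toℕ (colouring (i ↑ˡ b)) ≡ toℕ i
    colour-left i = cong toℕ (bySide-↑ˡ _ _ i) ⨾ toℕ-inject≤ i a<m

    colour-right : ∀ j → toℕ (colouring (suc a ↑ʳ j)) ≡ suc (toℕ j)
    colour-right j = cong toℕ (bySide-↑ʳ {suc a} _ _ j) ⨾ toℕ-inject≤ (1+ j) b<m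

    colour-zero⇒x* : ∀ {w} → Side (suc a) b w → toℕ (colouring w) ≡ 0 → w ≡ x*
    colour-zero⇒x* (left i) c≡0 = cong (_↑ˡ b) (toℕ-injective {j = 0F} (sym (colour-left i) ⨾ c≡0))
    colour-zero⇒x* (right j) c≡0 with sym (colour-right j) ⨾ c≡0
    ... | ()

  -- A colour-preserving automorphism fixes x*, the only vertex of colour 0, and hence
  -- preserves adjacency to x*, which tells the two sides apart.
  distinguishing : Distinguishing G colouring
  distinguishing = Distinguishing-by-labels colouring (λ u → G u x*) stable determines
    where
    stable : ∀ (φ : Aut G) → Preserves φ colouring → ∀ v → G (to (proj₁ φ) v) x* ≡ G v x*
    stable (f , aut) preserves v = cong (G (to f v)) (sym fixes-x*) ⨾ sym (aut v x*)
      where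
      fixes-x* : to f x* ≡ x*
      fixes-x* = colour-zero⇒x* (side (suc a) b _) (cong toℕ (preserves x*) ⨾ colour-left 0F)
    determines : ∀ {u v} → colouring u ≡ colouring v → G u x* ≡ G v x* → u ≡ v
    determines {u} {v} = go (side (suc a) b u) (side (suc a) b v)
      where
      go : Side (suc a) b u → Side (suc a) b v → colouring u ≡ colouring v → G u x* ≡ G v x* → u ≡ v
      go (left i) (left j) same _ =
        cong (_↑ˡ b) (toℕ-injective (sym (colour-left i) ⨾ cong toℕ same ⨾ colour-left j))
      go (right i) (right j) same _ =
        cong (suc a ↑ʳ_) (toℕ-injective (suc-injective
          (sym (colour-right i) ⨾ cong toℕ same ⨾ colour-right j)))
      go (left i) (right j) _ adj
        with sym (combine-ˡˡ true (Kbar (suc a)) (Kbar b) i 0F) ⨾ adj ⨾ combine-ʳˡ true (Kbar (suc a)) (Kbar b) j 0F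
      ... | ()
      go (right i) (left j) _ adj
        with sym (combine-ʳˡ true (Kbar (suc a)) (Kbar b) i 0F) ⨾ adj ⨾ combine-ˡˡ true (Kbar (suc a)) (Kbar b) j 0F
      ... | ()

module K+Kbar-rigid {a b m : ℕ} (a≤m : a ≤ m) (b≤m : b ≤ m) (2≤b : 2 ≤ b) where

  colouring : Fin (a + b) → Fin m
  colouring = bySide (λ i → inject≤ i a≤m) (λ j → inject≤ j b≤m)

  private
    G : Adj (a + b)
    G = K a +ᴳ Kbar b

    colour-left : ∀ i → colouring (i ↑ˡ b) ≡ inject≤ i a≤m
    colour-left = bySide-↑ˡ _ _

    colour-right : ∀ j → colouring (a ↑ʳ j) ≡ inject≤ j b≤m
    colour-right = bySide-↑ʳ {a} _ _

    left-universal : ∀ i → Universal G (i ↑ˡ b)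
    left-universal i v v≢u with side a b v
    ... | left k  = combine-ˡˡ true (K a) (Kbar b) i k ⨾ K-adjacent (λ i≡k → v≢u (cong (_↑ˡ b) (sym i≡k)))
    ... | right k = combine-ˡʳ true (K a) (Kbar b) i k

    right-not-universal : ∀ j → ¬ Universal G (a ↑ʳ j)
    right-not-universal j univ with another 2≤b j
    ... | j′ , j′≢j with sym (combine-ʳʳ true (K a) (Kbar b) j j′) ⨾ univ (a ↑ʳ j′) (λ e → j′≢j (↑ʳ-injective a _ _ e))
    ... | ()

    onLeft⇒universal : ∀ u → onLeft a u ≡ true → Universal G u
    onLeft⇒universal u with side a b u
    ... | left i  = λ _ → left-universal i
    ... | right j = λ onL → contradiction (sym onL ⨾ onLeft-↑ʳ {a} j) true≢false

    onRight⇒¬universal : ∀ u → onLeft a u ≡ false → ¬ Universal G u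
    onRight⇒¬universal u with side a b u
    ... | left i  = λ onR → contradiction (sym (onLeft-↑ˡ i) ⨾ onR) true≢false
    ... | right j = λ _ → right-not-universal j

    determines : ∀ {u v} → colouring u ≡ colouring v → onLeft a u ≡ onLeft a v → u ≡ v
    determines {u} {v} with side a b u | side a b v
    ... | left i  | left j  = λ same _ → cong (_↑ˡ b) (inject≤-injective _ _ i j
                                (sym (colour-left i) ⨾ same ⨾ colour-left j))
    ... | right i | right j = λ same _ → cong (a ↑ʳ_) (inject≤-injective _ _ i j
                                (sym (colour-right i) ⨾ same ⨾ colour-right j))
    ... | left i  | right j = λ _ onL → contradiction
                                (sym (onLeft-↑ˡ i) ⨾ onL ⨾ onLeft-↑ʳ {a} j) true≢false
    ... | right i | left j  = λ _ onL → contradiction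
                                (sym (onLeft-↑ˡ j) ⨾ sym onL ⨾ onLeft-↑ʳ {a} i) true≢false

  distinguishing : Distinguishing G colouring
  distinguishing = Distinguishing-by-labels colouring (onLeft a)
    (λ φ _ → label-stable (onLeft a) Universal-invariant onLeft⇒universal onRight⇒¬universal φ) determines

data Side₃ (a b : ℕ) : Fin (a + (b + 1)) → Set where
  inA : (i : Fin a) → Side₃ a b (i ↑ˡ (b + 1))
  inB : (j : Fin b) → Side₃ a b (a ↑ʳ (j ↑ˡ 1))
  isC : Side₃ a b (a ↑ʳ (b ↑ʳ 0F))

side₃ : ∀ a b u → Side₃ a b u
side₃ a b u with side a (b + 1) u
... | left i = inA i
... | right r with side b 1 r
...   | left j = inB j
...   | right 0F = isC

module K+[K∪K₁]-rigid {a b m : ℕ} (a≤m : a ≤ m) (b≤m : b ≤ m) (2≤b : 2 ≤ b) where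

  private
    I : Adj (b + 1)
    I = K b ∪ᴳ K 1
    G : Adj (a + (b + 1))
    G = K a +ᴳ I
    A : Fin a → Fin (a + (b + 1))
    A i = i ↑ˡ (b + 1)
    B : Fin b → Fin (a + (b + 1))
    B j = a ↑ʳ (j ↑ˡ 1)
    C : Fin (a + (b + 1))
    C = a ↑ʳ (b ↑ʳ 0F)
    j₀ : Fin b
    j₀ = inhabitant (<⇒≤ 2≤b)

  colouring : Fin (a + (b + 1)) → Fin m
  colouring = bySide (λ i → inject≤ i a≤m) (bySide (λ j → inject≤ j b≤m) (λ _ → inject≤ j₀ b≤m))

  private
    colour-A : ∀ i → colouring (A i) ≡ inject≤ i a≤m
    colour-A = bySide-↑ˡ _ _

    colour-B : ∀ j → colouring (B j) ≡ inject≤ j b≤m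
    colour-B j = bySide-↑ʳ {a} _ _ (j ↑ˡ 1) ⨾ bySide-↑ˡ _ _ j

    -- C is the only vertex without a non-universal neighbour.
    notC : Fin (a + (b + 1)) → Bool
    notC = bySide {a} (λ _ → true) (onLeft b)

    notC-A : ∀ i → notC (A i) ≡ true
    notC-A = bySide-↑ˡ _ _

    notC-B : ∀ j → notC (B j) ≡ true
    notC-B j = bySide-↑ʳ {a} _ _ (j ↑ˡ 1) ⨾ onLeft-↑ˡ j

    notC-C : notC C ≡ false
    notC-C = bySide-↑ʳ {a} _ _ (b ↑ʳ 0F) ⨾ onLeft-↑ʳ {b} 0F

    G-AA : ∀ i k → G (A i) (A k) ≡ K a i k
    G-AA = combine-ˡˡ true (K a) I

    G-BB : ∀ j k → G (B j) (B k) ≡ K b j k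
    G-BB j k = combine-ʳʳ true (K a) I (j ↑ˡ 1) (k ↑ˡ 1) ⨾ combine-ˡˡ false (K b) (K 1) j k

    G-BC : ∀ j → G (B j) C ≡ false
    G-BC j = combine-ʳʳ true (K a) I (j ↑ˡ 1) (b ↑ʳ 0F) ⨾ combine-ˡʳ false (K b) (K 1) j 0F

    G-CB : ∀ j → G C (B j) ≡ false
    G-CB j = combine-ʳʳ true (K a) I (b ↑ʳ 0F) (j ↑ˡ 1) ⨾ combine-ʳˡ false (K b) (K 1) 0F j

    G-CC : G C C ≡ false
    G-CC = combine-ʳʳ true (K a) I (b ↑ʳ 0F) (b ↑ʳ 0F) ⨾ combine-ʳʳ false (K b) (K 1) 0F 0F

    B≢C : ∀ j → B j ≢ C
    B≢C j B≡C = ↑ˡ≢↑ʳ j 0F (↑ʳ-injective a _ _ B≡C)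

    A-universal : ∀ i → Universal G (A i)
    A-universal i v v≢Ai with side₃ a b v
    ... | inA k = G-AA i k ⨾ K-adjacent (λ i≡k → v≢Ai (cong A (sym i≡k)))
    ... | inB _ = combine-ˡʳ true (K a) I i _
    ... | isC   = combine-ˡʳ true (K a) I i _

    B-not-universal : ∀ j → ¬ Universal G (B j)
    B-not-universal j univ = true≢false (sym (univ C (λ C≡B → B≢C j (sym C≡B))) ⨾ G-BC j)

    C-not-universal : ¬ Universal G C
    C-not-universal univ = true≢false (sym (univ (B j₀) (B≢C j₀)) ⨾ G-CB j₀)

    B-has-non-universal-neighbour : ∀ j → HasNonUniversalNeighbour G (B j)
    B-has-non-universal-neighbour j with another 2≤b j
    ... | j′ , j′≢j = B j′ , B-not-universal j′ , G-BB j j′ ⨾ K-adjacent (λ j≡j′ → j′≢j (sym j≡j′))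

    C-no-non-universal-neighbour : ¬ HasNonUniversalNeighbour G C
    C-no-non-universal-neighbour (v , ¬univ , Cv) with side₃ a b v
    ... | inA i = ¬univ (A-universal i)
    ... | inB j = true≢false (sym Cv ⨾ G-CB j)
    ... | isC   = true≢false (sym Cv ⨾ G-CC)

    onLeft⇒universal : ∀ u → onLeft a u ≡ true → Universal G u
    onLeft⇒universal u with side₃ a b u
    ... | inA i = λ _ → A-universal i
    ... | inB j = λ onL → contradiction (sym onL ⨾ onLeft-↑ʳ {a} (j ↑ˡ 1)) true≢false
    ... | isC   = λ onL → contradiction (sym onL ⨾ onLeft-↑ʳ {a} (b ↑ʳ 0F)) true≢false

    onRight⇒¬universal : ∀ u → onLeft a u ≡ false → ¬ Universal G u
    onRight⇒¬universal u with side₃ a b u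
    ... | inA i = λ onR → contradiction (sym (onLeft-↑ˡ i) ⨾ onR) true≢false
    ... | inB j = λ _ → B-not-universal j
    ... | isC   = λ _ → C-not-universal

    notC⇒neighbour : ∀ u → notC u ≡ true → HasNonUniversalNeighbour G u
    notC⇒neighbour u with side₃ a b u
    ... | inA i = λ _ → B j₀ , B-not-universal j₀ , combine-ˡʳ true (K a) I i _
    ... | inB j = λ _ → B-has-non-universal-neighbour j
    ... | isC   = λ nC → contradiction (sym nC ⨾ notC-C) true≢false

    C⇒¬neighbour : ∀ u → notC u ≡ false → ¬ HasNonUniversalNeighbour G u
    C⇒¬neighbour u with side₃ a b u
    ... | inA i = λ nC → contradiction (sym (notC-A i) ⨾ nC) true≢false
    ... | inB j = λ nC → contradiction (sym (notC-B j) ⨾ nC) true≢false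
    ... | isC   = λ _ → C-no-non-universal-neighbour

    label : Fin (a + (b + 1)) → Bool × Bool
    label u = onLeft a u , notC u

    label-stable₂ : ∀ (φ : Aut G) u → label (to (proj₁ φ) u) ≡ label u
    label-stable₂ φ u = cong₂ _,_
      (label-stable (onLeft a) Universal-invariant onLeft⇒universal onRight⇒¬universal φ u)
      (label-stable notC HasNonUniversalNeighbour-invariant notC⇒neighbour C⇒¬neighbour φ u)

    determines : ∀ {u v} → colouring u ≡ colouring v → label u ≡ label v → u ≡ v
    determines {u} {v} with side₃ a b u | side₃ a b v
    ... | inA i | inA k = λ same _ → cong A (inject≤-injective _ _ i k
                            (sym (colour-A i) ⨾ same ⨾ colour-A k))
    ... | inB j | inB k = λ same _ → cong B (inject≤-injective _ _ j k
                            (sym (colour-B j) ⨾ same ⨾ colour-B k))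
    ... | isC   | isC   = λ _ _ → refl
    ... | inA i | inB k = λ _ lab → contradiction (sym (onLeft-↑ˡ i) ⨾ cong proj₁ lab ⨾ onLeft-↑ʳ {a} (k ↑ˡ 1)) true≢false
    ... | inA i | isC   = λ _ lab → contradiction (sym (onLeft-↑ˡ i) ⨾ cong proj₁ lab ⨾ onLeft-↑ʳ {a} (b ↑ʳ 0F)) true≢false
    ... | inB j | inA k = λ _ lab → contradiction (sym (onLeft-↑ˡ k) ⨾ sym (cong proj₁ lab) ⨾ onLeft-↑ʳ {a} (j ↑ˡ 1)) true≢false
    ... | isC   | inA k = λ _ lab → contradiction (sym (onLeft-↑ˡ k) ⨾ sym (cong proj₁ lab) ⨾ onLeft-↑ʳ {a} (b ↑ʳ 0F)) true≢false
    ... | inB j | isC   = λ _ lab → contradiction (sym (notC-B j) ⨾ cong proj₂ lab ⨾ notC-C) true≢false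
    ... | isC   | inB k = λ _ lab → contradiction (sym (notC-B k) ⨾ sym (cong proj₂ lab) ⨾ notC-C) true≢false

  distinguishing : Distinguishing G colouring
  distinguishing = Distinguishing-by-labels colouring label (λ φ _ → label-stable₂ φ) determines

injective⇒surjective : ∀ {a} {f : Fin a → Fin a} → Injective _≡_ _≡_ f → ∀ k → ∃ λ j → f j ≡ k
injective⇒surjective {suc a} {f} f-injective k with any? (λ j → f j ≟ k)
... | yes hit = hit
... | no miss = contradiction (injective⇒≤ punched-injective) 1+n≰n
  where
  punched : Fin (suc a) → Fin a
  punched j = punchOut {i = k} {j = f j} (λ k≡fj → miss (j , sym k≡fj))
  punched-injective : Injective _≡_ _≡_ punched
  punched-injective {x} {y} same = f-injective (punchOut-injective {i = k} _ _ same)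

↑ˡ-Injective : ∀ {a} b → Injective _≡_ _≡_ (λ (i : Fin a) → i ↑ˡ b)
↑ˡ-Injective b = ↑ˡ-injective b _ _

↑ʳ-Injective : ∀ a {b} → Injective _≡_ _≡_ (λ (j : Fin b) → a ↑ʳ j)
↑ʳ-Injective a = ↑ʳ-injective a _ _

Kbip-simple : ∀ a b → IsSimple (Kbip a b)
Kbip-simple a b = combine-simple true (Kbar a) (Kbar b) (Kbar-simple a) (Kbar-simple b)

-- A distinguishing a-colouring of K_{a,a} would be injective on both sides, so matching
-- colours across the sides gives a colour-preserving automorphism exchanging them.
Kbip-balanced-not-distinguishing : ∀ a (c : Fin (suc a + suc a) → Fin (suc a)) →
  ¬ Distinguishing (Kbip (suc a) (suc a)) c
Kbip-balanced-not-distinguishing a c dist =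
  ↑ˡ≢↑ʳ 0F (σR (cL 0F)) (sym (dist (mk↔ₛ′ ψ ψ ψ-involutive ψ-involutive , ψ-aut) ψ-preserves (0F ↑ˡ A)) ⨾ ψ-↑ˡ 0F)
  where
  A : ℕ
  A = suc a
  G : Adj (A + A)
  G = Kbip A A
  simple : IsSimple G
  simple = Kbip-simple A A
  cL : Fin A → Fin A
  cL i = c (i ↑ˡ A)
  cR : Fin A → Fin A
  cR j = c (A ↑ʳ j)
  cL-injective : Injective _≡_ _≡_ cL
  cL-injective = Distinguishing⇒twins-injective simple c dist (_↑ˡ A) (↑ˡ-Injective A)
                   (λ i j → twin-↑ˡ true (Kbar A) (Kbar A) (Kbar-twins i j))
  cR-injective : Injective _≡_ _≡_ cR
  cR-injective = Distinguishing⇒twins-injective simple c dist (A ↑ʳ_) (↑ʳ-Injective A)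
                   (λ i j → twin-↑ʳ true (Kbar A) (Kbar A) (Kbar-twins i j))
  σL σR : Fin A → Fin A
  σL k = proj₁ (injective⇒surjective cL-injective k)
  σR k = proj₁ (injective⇒surjective cR-injective k)
  σL-section : ∀ k → cL (σL k) ≡ k
  σL-section k = proj₂ (injective⇒surjective cL-injective k)
  σR-section : ∀ k → cR (σR k) ≡ k
  σR-section k = proj₂ (injective⇒surjective cR-injective k)
  ψ : Fin (A + A) → Fin (A + A)
  ψ = bySide (λ i → A ↑ʳ σR (cL i)) (λ j → σL (cR j) ↑ˡ A)
  ψ-↑ˡ : ∀ i → ψ (i ↑ˡ A) ≡ A ↑ʳ σR (cL i)
  ψ-↑ˡ = bySide-↑ˡ _ _
  ψ-↑ʳ : ∀ j → ψ (A ↑ʳ j) ≡ σL (cR j) ↑ˡ A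
  ψ-↑ʳ = bySide-↑ʳ {A} _ _
  ψ-involutive : ∀ u → ψ (ψ u) ≡ u
  ψ-involutive u with side A A u
  ... | left i  = cong ψ (ψ-↑ˡ i) ⨾ ψ-↑ʳ _ ⨾ cong (_↑ˡ A) (cL-injective (σL-section _ ⨾ σR-section _))
  ... | right j = cong ψ (ψ-↑ʳ j) ⨾ ψ-↑ˡ _ ⨾ cong (A ↑ʳ_) (cR-injective (σR-section _ ⨾ σL-section _))
  ψ-aut : ∀ u v → G u v ≡ G (ψ u) (ψ v)
  ψ-aut u v with side A A u | side A A v
  ... | left i  | left j  = combine-ˡˡ true (Kbar A) (Kbar A) i j
                            ⨾ sym (cong₂ G (ψ-↑ˡ i) (ψ-↑ˡ j) ⨾ combine-ʳʳ true (Kbar A) (Kbar A) (σR (cL i)) (σR (cL j)))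
  ... | left i  | right j = combine-ˡʳ true (Kbar A) (Kbar A) i j
                            ⨾ sym (cong₂ G (ψ-↑ˡ i) (ψ-↑ʳ j) ⨾ combine-ʳˡ true (Kbar A) (Kbar A) (σR (cL i)) (σL (cR j)))
  ... | right i | left j  = combine-ʳˡ true (Kbar A) (Kbar A) i j
                            ⨾ sym (cong₂ G (ψ-↑ʳ i) (ψ-↑ˡ j) ⨾ combine-ˡʳ true (Kbar A) (Kbar A) (σL (cR i)) (σR (cL j)))
  ... | right i | right j = combine-ʳʳ true (Kbar A) (Kbar A) i j
                            ⨾ sym (cong₂ G (ψ-↑ʳ i) (ψ-↑ʳ j) ⨾ combine-ˡˡ true (Kbar A) (Kbar A) (σL (cR i)) (σL (cR j)))
  ψ-preserves : ∀ v → c (ψ v) ≡ c v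
  ψ-preserves v with side A A v
  ... | left i  = cong c (ψ-↑ˡ i) ⨾ σR-section _
  ... | right j = cong c (ψ-↑ʳ j) ⨾ σL-section _

DistNum-Kbip-< : ∀ {a b} → b < a → DistNum (Kbip a b) a
DistNum-Kbip-< {suc a} {b} b<a =
  (_ , Kbip-rigid.distinguishing ≤-refl b<a) ,
  twins-bound-colours (Kbip-simple (suc a) b) (_↑ˡ b) (↑ˡ-Injective b)
    (λ i j → twin-↑ˡ true (Kbar (suc a)) (Kbar b) (Kbar-twins i j))

DistNum-Kbip-≡ : ∀ a → DistNum (Kbip (suc a) (suc a)) (suc (suc a))
DistNum-Kbip-≡ a = (_ , Kbip-rigid.distinguishing (n≤1+n _) ≤-refl) , fewer
  where
  fewer : ∀ k → k < suc (suc a) → (c : Fin (suc a + suc a) → Fin k) → ¬ Distinguishing (Kbip (suc a) (suc a)) c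
  fewer k (s≤s k≤1+a) with m≤n⇒m<n∨m≡n k≤1+a
  ... | inj₁ k<1+a = twins-bound-colours (Kbip-simple (suc a) (suc a)) (_↑ˡ suc a) (↑ˡ-Injective (suc a))
                       (λ i j → twin-↑ˡ true (Kbar (suc a)) (Kbar (suc a)) (Kbar-twins i j)) k k<1+a
  ... | inj₂ refl = Kbip-balanced-not-distinguishing a

DistNum-K+Kbar : ∀ {a b} → 2 ≤ b → DistNum (K a +ᴳ Kbar b) (a ⊔ b)
DistNum-K+Kbar {a} {b} 2≤b =
  (_ , K+Kbar-rigid.distinguishing (m≤m⊔n a b) (m≤n⊔m a b) 2≤b) , fewer (⊔-sel a b)
  where
  simple : IsSimple (K a +ᴳ Kbar b)
  simple = combine-simple true (K a) (Kbar b) (K-simple a) (Kbar-simple b)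
  fewer : a ⊔ b ≡ a ⊎ a ⊔ b ≡ b → ∀ k → k < a ⊔ b → (c : Fin (a + b) → Fin k) → ¬ Distinguishing (K a +ᴳ Kbar b) c
  fewer (inj₁ ⊔≡a) k k< = twins-bound-colours simple (_↑ˡ b) (↑ˡ-Injective b)
    (λ i j → twin-↑ˡ true (K a) (Kbar b) (K-twins i j)) k (subst (k <_) ⊔≡a k<)
  fewer (inj₂ ⊔≡b) k k< = twins-bound-colours simple (a ↑ʳ_) (↑ʳ-Injective a)
    (λ i j → twin-↑ʳ true (K a) (Kbar b) (Kbar-twins i j)) k (subst (k <_) ⊔≡b k<)

DistNum-K+[K∪K₁] : ∀ {a b} → 2 ≤ b → DistNum (K a +ᴳ (K b ∪ᴳ K 1)) (a ⊔ b)
DistNum-K+[K∪K₁] {a} {b} 2≤b =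
  (_ , K+[K∪K₁]-rigid.distinguishing (m≤m⊔n a b) (m≤n⊔m a b) 2≤b) , fewer (⊔-sel a b)
  where
  G : Adj (a + (b + 1))
  G = K a +ᴳ (K b ∪ᴳ K 1)
  simple : IsSimple G
  simple = combine-simple true (K a) (K b ∪ᴳ K 1) (K-simple a)
             (combine-simple false (K b) (K 1) (K-simple b) (K-simple 1))
  fewer : a ⊔ b ≡ a ⊎ a ⊔ b ≡ b → ∀ k → k < a ⊔ b → (c : Fin (a + (b + 1)) → Fin k) → ¬ Distinguishing G c
  fewer (inj₁ ⊔≡a) k k< = twins-bound-colours simple (_↑ˡ (b + 1)) (↑ˡ-Injective (b + 1))
    (λ i j → twin-↑ˡ true (K a) (K b ∪ᴳ K 1) (K-twins i j)) k (subst (k <_) ⊔≡a k<)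
  fewer (inj₂ ⊔≡b) k k< = twins-bound-colours simple (λ j → a ↑ʳ (j ↑ˡ 1))
    (λ same → ↑ˡ-Injective 1 (↑ʳ-Injective a same))
    (λ i j → twin-↑ʳ true (K a) (K b ∪ᴳ K 1) (twin-↑ˡ false (K b) (K 1) (K-twins i j))) k (subst (k <_) ⊔≡b k<)

DistNum-K+Kbar-≤ : ∀ {a b} → a ≤ b → 2 ≤ b → DistNum (K a +ᴳ Kbar b) b
DistNum-K+Kbar-≤ a≤b 2≤b = subst (DistNum _) (m≤n⇒m⊔n≡n a≤b) (DistNum-K+Kbar 2≤b)

DistNum-K+Kbar-≥ : ∀ {a b} → b ≤ a → 2 ≤ b → DistNum (K a +ᴳ Kbar b) a
DistNum-K+Kbar-≥ b≤a 2≤b = subst (DistNum _) (m≥n⇒m⊔n≡m b≤a) (DistNum-K+Kbar 2≤b)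

DistNum-K+[K∪K₁]-≤ : ∀ {a b} → a ≤ b → 2 ≤ b → DistNum (K a +ᴳ (K b ∪ᴳ K 1)) b
DistNum-K+[K∪K₁]-≤ a≤b 2≤b = subst (DistNum _) (m≤n⇒m⊔n≡n a≤b) (DistNum-K+[K∪K₁] 2≤b)

DistNum-K+[K∪K₁]-≥ : ∀ {a b} → b ≤ a → 2 ≤ b → DistNum (K a +ᴳ (K b ∪ᴳ K 1)) a
DistNum-K+[K∪K₁]-≥ b≤a 2≤b = subst (DistNum _) (m≥n⇒m⊔n≡m b≤a) (DistNum-K+[K∪K₁] 2≤b)

-- Distances and resolving sets

least-witness : ∀ {P : ℕ → Set} → Decidable P → ∀ {k} → P k → ∃ λ d → P d × (∀ j → j < d → ¬ P j)
least-witness P? {k} p with P? 0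
... | yes p0 = 0 , p0 , λ _ ()
least-witness P? {zero} p | no ¬p0 = contradiction p ¬p0
least-witness P? {suc k} p | no ¬p0 with least-witness (λ j → P? (suc j)) p
... | d , pd , below = suc d , pd , λ { zero _ → ¬p0 ; (suc j) (s≤s j<d) → below j j<d }

module _ {n} {G : Adj n} where

  walk? : ∀ u v k → Dec (Walk G u v k)
  walk? u v zero with u ≟ v
  ... | yes refl = yes here
  ... | no u≢v = no λ { here → u≢v refl }
  walk? u v (suc k) with any? (λ w → (G u w ≟ᵇ true) ×-dec walk? w v k)
  ... | yes (w , uw , p) = yes (step uw p)
  ... | no none = no λ { (step {w = w} uw p) → none (w , uw , p) }

  Walk⇒Dist : ∀ {u v k} → Walk G u v k → ∃ (Dist G u v)
  Walk⇒Dist = least-witness (walk? _ _)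

  Dist-functional : ∀ {u v d d′} → Dist G u v d → Dist G u v d′ → d ≡ d′
  Dist-functional {d = d} {d′} (p , shortest) (p′ , shortest′) with <-cmp d d′
  ... | tri< d<d′ _ _ = contradiction p (shortest′ d d<d′)
  ... | tri≈ _ d≡d′ _ = d≡d′
  ... | tri> _ _ d′<d = contradiction p′ (shortest d′ d′<d)

  Dist-refl : ∀ u → Dist G u u 0
  Dist-refl u = here , λ _ ()

  Dist-adjacent : ∀ {u v} → G u v ≡ true → u ≢ v → Dist G u v 1
  Dist-adjacent uv u≢v = step uv here , λ { zero _ here → u≢v refl ; (suc k) (s≤s ()) _ }

  Dist-one⇒adjacent : ∀ {u v} → Dist G u v 1 → G u v ≡ true
  Dist-one⇒adjacent (step uv here , _) = uv

  Dist-suc⇒≢ : ∀ {u v k} → Dist G u v (suc k) → u ≢ v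
  Dist-suc⇒≢ (_ , shortest) refl = shortest 0 (s≤s z≤n) here

  Dist-zero⇒≡ : ∀ {u v} → Dist G u v 0 → u ≡ v
  Dist-zero⇒≡ (here , _) = refl

  Walk-two⇒common-neighbour : ∀ {u v} → Walk G u v 2 → ∃ λ w → G u w ≡ true × G w v ≡ true
  Walk-two⇒common-neighbour (step uw (step wv here)) = _ , uw , wv

  private
    walk-snoc : ∀ {u w v k} → Walk G u w k → G w v ≡ true → Walk G u v (suc k)
    walk-snoc here wv = step wv here
    walk-snoc (step uw p) wv = step uw (walk-snoc p wv)

    walk-unsnoc : ∀ {u v k} → Walk G u v (suc k) → ∃ λ w → Walk G u w k × G w v ≡ true
    walk-unsnoc (step uv here) = _ , here , uv
    walk-unsnoc (step uw (step wx p)) with walk-unsnoc (step wx p)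
    ... | y , q , yv = y , step uw q , yv

  Dist-predecessor : ∀ {u v k} → Dist G u v (suc k) → ∃ λ w → Dist G u w k × G w v ≡ true
  Dist-predecessor (p , shortest) with walk-unsnoc p
  ... | w , q , wv = w , (q , λ j j<k walk → shortest (suc j) (s≤s j<k) (walk-snoc walk wv)) , wv

member : ∀ {n} (p : Subset n) → 1 ≤ ∣ p ∣ → ∃ λ x → x ∈ p
member (true ∷ p) _ = 0F , here
member (false ∷ p) 1≤∣p∣ with member p 1≤∣p∣
... | x , x∈p = 1+ x , there x∈p

two-members : ∀ {n} (p : Subset n) → 2 ≤ ∣ p ∣ → ∃₂ λ x y → x ≢ y × x ∈ p × y ∈ p
two-members (true ∷ p) (s≤s 1≤∣p∣) with member p 1≤∣p∣
... | y , y∈p = 0F , 1+ y , (λ ()) , here , there y∈p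
two-members (false ∷ p) 2≤∣p∣ with two-members p 2≤∣p∣
... | x , y , x≢y , x∈p , y∈p = 1+ x , 1+ y , (λ e → x≢y (1+-injective e)) , there x∈p , there y∈p

ResolvedOutside : ∀ {n} → Adj n → (x y z p q : Fin n) → Set
ResolvedOutside G x y z p q = ∃ λ s → s ≢ x × s ≢ y × s ≢ z ×
  ∃₂ λ d₁ d₂ → Dist G s p d₁ × Dist G s q d₂ × d₁ ≢ d₂

-- If each pair of x, y, z is resolved by some other vertex, all vertices but x, y, z resolve G.
no-three-pairwise-resolved : ∀ {n} {G : Adj n} → Connected G → MetricDim G (n ∸ 2) →
  ∀ {x y z} → x ≢ y → x ≢ z → y ≢ z →
  ResolvedOutside G x y z x y → ResolvedOutside G x y z x z → ResolvedOutside G x y z y z → ⊥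
no-three-pairwise-resolved {suc n} {G} connected (_ , minimal) {x} {y} {z} x≢y x≢z y≢z rxy rxz ryz =
  <⇒≱ ∣S∣<n∸2 (minimal S resolving)
  where
  S : Subset (suc n)
  S = ∁ ⁅ x ⁆ - y - z

  ∈∁⁅x⁆ : ∀ {w} → w ≢ x → w ∈ ∁ ⁅ x ⁆
  ∈∁⁅x⁆ w≢x = x∉p⇒x∈∁p (w≢x ∘ x∈⁅y⁆⇒x≡y _)

  ∈S : ∀ {w} → w ≢ x → w ≢ y → w ≢ z → w ∈ S
  ∈S w≢x w≢y w≢z = x∈p∧x≢y⇒x∈p-y (x∈p∧x≢y⇒x∈p-y (∈∁⁅x⁆ w≢x) w≢y) w≢z

  ∣S∣<n∸2 : ∣ S ∣ < suc n ∸ 2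
  ∣S∣<n∸2 = shift (begin
    suc (suc ∣ S ∣)      ≤⟨ s≤s (x∈p⇒∣p-x∣<∣p∣ (x∈p∧x≢y⇒x∈p-y (∈∁⁅x⁆ (≢-sym x≢z)) (≢-sym y≢z))) ⟩
    suc ∣ ∁ ⁅ x ⁆ - y ∣  ≤⟨ x∈p⇒∣p-x∣<∣p∣ (∈∁⁅x⁆ (≢-sym x≢y)) ⟩
    ∣ ∁ ⁅ x ⁆ ∣          ≡⟨ ∣∁p∣≡n∸∣p∣ ⁅ x ⁆ ⨾ cong (suc n ∸_) (∣⁅x⁆∣≡1 x) ⟩
    suc n ∸ 1            ∎)
    where
    open ≤-Reasoning
    shift : ∀ {s m} → suc (suc s) ≤ m → suc s ≤ m ∸ 1
    shift (s≤s le) = le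

  distance : ∀ u v → ∃ (Dist G u v)
  distance u v = Walk⇒Dist (proj₂ (connected u v))

  Resolves : Fin (suc n) → Fin (suc n) → Set
  Resolves u v = ∃ λ s → s ∈ S × ∃₂ λ d₁ d₂ → Dist G s u d₁ × Dist G s v d₂ × d₁ ≢ d₂

  by-itself : ∀ {u v} → u ∈ S → u ≢ v → Resolves u v
  by-itself {u} {v} u∈S u≢v with distance u v
  ... | zero , d = contradiction (Dist-zero⇒≡ d) u≢v
  ... | suc k , d = u , u∈S , 0 , suc k , Dist-refl u , d , λ ()

  flip : ∀ {u v} → Resolves u v → Resolves v u
  flip (s , s∈S , d₁ , d₂ , du , dv , d₁≢d₂) = s , s∈S , d₂ , d₁ , dv , du , λ e → d₁≢d₂ (sym e)

  by-outsider : ∀ {p q} → ResolvedOutside G x y z p q → Resolves p q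
  by-outsider (s , s≢x , s≢y , s≢z , rest) = s , ∈S s≢x s≢y s≢z , rest

  classify : ∀ w → w ≡ x ⊎ w ≡ y ⊎ w ≡ z ⊎ w ∈ S
  classify w with w ≟ x | w ≟ y | w ≟ z
  ... | yes w≡x | _ | _ = inj₁ w≡x
  ... | no _ | yes w≡y | _ = inj₂ (inj₁ w≡y)
  ... | no _ | no _ | yes w≡z = inj₂ (inj₂ (inj₁ w≡z))
  ... | no w≢x | no w≢y | no w≢z = inj₂ (inj₂ (inj₂ (∈S w≢x w≢y w≢z)))

  resolving : Resolving G S
  resolving u v u≢v with classify u | classify v
  ... | inj₂ (inj₂ (inj₂ u∈S)) | _ = by-itself u∈S u≢v
  ... | _ | inj₂ (inj₂ (inj₂ v∈S)) = flip (by-itself v∈S (λ v≡u → u≢v (sym v≡u)))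
  ... | inj₁ refl | inj₁ refl = contradiction refl u≢v
  ... | inj₁ refl | inj₂ (inj₁ refl) = by-outsider rxy
  ... | inj₁ refl | inj₂ (inj₂ (inj₁ refl)) = by-outsider rxz
  ... | inj₂ (inj₁ refl) | inj₁ refl = flip (by-outsider rxy)
  ... | inj₂ (inj₁ refl) | inj₂ (inj₁ refl) = contradiction refl u≢v
  ... | inj₂ (inj₁ refl) | inj₂ (inj₂ (inj₁ refl)) = by-outsider ryz
  ... | inj₂ (inj₂ (inj₁ refl)) | inj₁ refl = flip (by-outsider rxz)
  ... | inj₂ (inj₂ (inj₁ refl)) | inj₂ (inj₁ refl) = flip (by-outsider ryz)
  ... | inj₂ (inj₂ (inj₁ refl)) | inj₂ (inj₂ (inj₁ refl)) = contradiction refl u≢v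

∈-∁-distinct : ∀ {n} {S : Subset n} {s x} → s ∈ S → x ∈ ∁ S → s ≢ x
∈-∁-distinct s∈S x∈∁S refl = x∈∁p⇒x∉p x∈∁S s∈S

-- Graphs of metric dimension n − 2

-- K_{a,b}, K_a + \overline{K_b} and K_a + (K_b ∪ K_1), with P marking the first part.
data Shape {n} (G : Adj n) : Set where
  Kbip-shape : (P : Fin n → Bool) →
    (∀ u v → P u ≡ P v → G u v ≡ false) → (∀ u v → P u ≢ P v → G u v ≡ true) → Shape G
  K+Kbar-shape : (P : Fin n → Bool) →
    (∀ u v → u ≢ v → P u ≡ true → G u v ≡ true) → (∀ u v → P u ≡ false → P v ≡ false → G u v ≡ false) →
    (∃₂ λ v₁ v₂ → v₁ ≢ v₂ × P v₁ ≡ false × P v₂ ≡ false) → Shape G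
  K+[K∪K₁]-shape : (P : Fin n → Bool) (c : Fin n) → P c ≡ false →
    (∀ u v → u ≢ v → u ≢ c → v ≢ c → G u v ≡ true) →
    (∀ u → P u ≡ true → G u c ≡ true) → (∀ u → P u ≡ false → G u c ≡ false) →
    (∃₂ λ v₁ v₂ → v₁ ≢ v₂ × P v₁ ≡ false × P v₂ ≡ false × v₁ ≢ c × v₂ ≢ c) → Shape G

module DimensionNMinusTwo {n} {G : Adj n} (simple : IsSimple G) (connected : Connected G)
                          (4≤n : 4 ≤ n) (dim : MetricDim G (n ∸ 2)) where

  open TwinProperties simple public

  private
    sym-G = proj₁ simple
    irrefl-G = proj₂ simple

  x₀ : Fin n
  x₀ = inhabitant (≤-trans (s≤s z≤n) 4≤n)

  distance : ∀ u v → ∃ (Dist G u v)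
  distance u v = Walk⇒Dist (proj₂ (connected u v))

  no-three-resolved : ∀ {x y z} → x ≢ y → x ≢ z → y ≢ z →
    ResolvedOutside G x y z x y → ResolvedOutside G x y z x z → ResolvedOutside G x y z y z → ⊥
  no-three-resolved = no-three-pairwise-resolved connected dim

  adjacency-resolves : ∀ {x y z s p q} → s ≢ x → s ≢ y → s ≢ z → s ≢ p → s ≢ q →
    G s p ≢ G s q → ResolvedOutside G x y z p q
  adjacency-resolves {s = s} {p} {q} s≢x s≢y s≢z s≢p s≢q differ with G s p in sp | distance s p | distance s q
  ... | true  | _ | d , sq = s , s≢x , s≢y , s≢z , 1 , d , Dist-adjacent sp s≢p , sq ,
                             λ { refl → differ (sym (Dist-one⇒adjacent sq)) }
  ... | false | d , sp′ | _ = s , s≢x , s≢y , s≢z , d , 1 , sp′ , Dist-adjacent (differs-from-false differ refl) s≢q ,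
                              λ { refl → true≢false (sym (Dist-one⇒adjacent sp′) ⨾ sp) }

  -- A shortest path of length ≥ 3 from u to v ends in v, v₁, v₂ at three distinct distances from u.
  diameter-two : ∀ {u v} → u ≢ v → G u v ≡ false → ∃ λ w → G u w ≡ true × G w v ≡ true
  diameter-two {u} {v} u≢v ¬uv with distance u v
  ... | zero , d = contradiction (Dist-zero⇒≡ d) u≢v
  ... | suc zero , d = contradiction (sym (Dist-one⇒adjacent d) ⨾ ¬uv) true≢false
  ... | suc (suc zero) , d = Walk-two⇒common-neighbour (proj₁ d)
  ... | suc (suc (suc k)) , d with Dist-predecessor d
  ...   | v₁ , d₁ , _ with Dist-predecessor d₁
  ...     | v₂ , d₂ , _ = ⊥-elim (no-three-resolved (apart d d₁ 3+k≢2+k) (apart d d₂ 3+k≢1+k) (apart d₁ d₂ 2+k≢1+k)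
                            (by-u d d₁ 3+k≢2+k) (by-u d d₂ 3+k≢1+k) (by-u d₁ d₂ 2+k≢1+k))
    where
    3+k≢2+k : suc (suc (suc k)) ≢ suc (suc k)
    3+k≢2+k = 1+n≢n
    2+k≢1+k : suc (suc k) ≢ suc k
    2+k≢1+k = 1+n≢n
    3+k≢1+k : suc (suc (suc k)) ≢ suc k
    3+k≢1+k ()
    apart : ∀ {a b i j} → Dist G u a i → Dist G u b j → i ≢ j → a ≢ b
    apart da db i≢j refl = i≢j (Dist-functional da db)
    by-u : ∀ {a b i j} → Dist G u a i → Dist G u b j → i ≢ j → ResolvedOutside G v v₁ v₂ a b
    by-u da db i≢j = u , Dist-suc⇒≢ d , Dist-suc⇒≢ d₁ , Dist-suc⇒≢ d₂ , _ , _ , da , db , i≢j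

  -- An optimal resolving set misses two vertices; a resolver of that pair is non-adjacent to one of them.
  not-complete : ∃₂ λ x y → x ≢ y × G x y ≡ false
  not-complete with proj₁ dim
  ... | S , resolving , ∣S∣≡n-2 with two-members (∁ S) 2≤∣∁S∣
    where
    2≤∣∁S∣ : 2 ≤ _
    2≤∣∁S∣ = ≤-reflexive (sym (∣∁p∣≡n∸∣p∣ S ⨾ cong (n ∸_) ∣S∣≡n-2 ⨾ m∸[m∸n]≡n (≤-trans (s≤s (s≤s z≤n)) 4≤n)))
  ... | x , y , x≢y , x∉S , y∉S with resolving x y x≢y
  ...   | s , s∈S , d₁ , d₂ , dx , dy , d₁≢d₂ with G s x in sx | G s y in sy
  ...     | false | _ = s , x , ∈-∁-distinct s∈S x∉S , sx
  ...     | true | false = s , y , ∈-∁-distinct s∈S y∉S , sy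
  ...     | true | true = contradiction (Dist-functional dx (Dist-adjacent sx (∈-∁-distinct s∈S x∉S))
                            ⨾ sym (Dist-functional dy (Dist-adjacent sy (∈-∁-distinct s∈S y∉S)))) d₁≢d₂

  SeparatedOnlyBy : Fin n → Fin n → Fin n → Set
  SeparatedOnlyBy x y z = AlikeOutside G x y z × G z x ≢ G z y

  SeparatedOnlyBy-swap : ∀ {x y z} → SeparatedOnlyBy x y z → SeparatedOnlyBy y x z
  SeparatedOnlyBy-swap (alike , differ) = (λ w w≢y w≢x w≢z → sym (alike w w≢x w≢y w≢z)) , λ e → differ (sym e)

  SeparatedOnlyBy-unique : ∀ {x y z w} → SeparatedOnlyBy x y z → SeparatedOnlyBy x y w →
    w ≢ x → w ≢ y → w ≢ z → ⊥
  SeparatedOnlyBy-unique (alike , _) (_ , differ) w≢x w≢y w≢z = differ (alike _ w≢x w≢y w≢z)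

  ¬Twin⇒SeparatedOnlyBy : ∀ {x y z} → ¬ Twin G x y → AlikeOutside G x y z → SeparatedOnlyBy x y z
  ¬Twin⇒SeparatedOnlyBy {z = z} ¬twin alike with ¬Twin⇒separator ¬twin
  ... | w , w≢x , w≢y , differ with w ≟ z
  ...   | yes refl = alike , differ
  ...   | no w≢z = contradiction (alike w w≢x w≢y w≢z) differ

  -- Otherwise each pair of x, y, z would be separated, hence resolved, by an outside neighbour.
  three-non-twins : ∀ {x y z} → ¬ Twin G x y → ¬ Twin G x z → ¬ Twin G y z →
    SeparatedOnlyBy x y z ⊎ SeparatedOnlyBy x z y ⊎ SeparatedOnlyBy y z x
  three-non-twins {x} {y} {z} ¬xy ¬xz ¬yz with alikeOutside? x y z | alikeOutside? x z y | alikeOutside? y z x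
  ... | yes alike | _ | _ = inj₁ (¬Twin⇒SeparatedOnlyBy ¬xy alike)
  ... | no _ | yes alike | _ = inj₂ (inj₁ (¬Twin⇒SeparatedOnlyBy ¬xz alike))
  ... | no _ | no _ | yes alike = inj₂ (inj₂ (¬Twin⇒SeparatedOnlyBy ¬yz alike))
  ... | no ¬axy | no ¬axz | no ¬ayz
    with ¬AlikeOutside⇒separator ¬axy | ¬AlikeOutside⇒separator ¬axz | ¬AlikeOutside⇒separator ¬ayz
  ...   | s₁ , s₁≢x , s₁≢y , s₁≢z , d₁ | s₂ , s₂≢x , s₂≢z , s₂≢y , d₂ | s₃ , s₃≢y , s₃≢z , s₃≢x , d₃ =
    ⊥-elim (no-three-resolved (¬Twin⇒≢ ¬xy) (¬Twin⇒≢ ¬xz) (¬Twin⇒≢ ¬yz)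
      (adjacency-resolves s₁≢x s₁≢y s₁≢z s₁≢x s₁≢y d₁)
      (adjacency-resolves s₂≢x s₂≢y s₂≢z s₂≢x s₂≢z d₂)
      (adjacency-resolves s₃≢x s₃≢y s₃≢z s₃≢y s₃≢z d₃))

  -- The configuration left over in chained-separations: the four sole separations place x, y, z, w on a
  -- path (G x y ≡ true) or on the complement of one (G x y ≡ false). Its two ends are non-adjacent, and
  -- together with a common neighbour v they form a pairwise resolved triple.
  private
    path-configuration-adjacent : ∀ {x y z w} → x ≢ y → x ≢ z → x ≢ w → y ≢ z → y ≢ w → z ≢ w →
      SeparatedOnlyBy x y z → SeparatedOnlyBy x w y → SeparatedOnlyBy z w x → AlikeOutside G y z w →
      G x y ≡ true → ⊥
    path-configuration-adjacent {x} {y} {z} {w} x≢y x≢z x≢w y≢z y≢w z≢w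
      (alike₁ , _) (alike₂ , differ₂) (alike₃ , differ₃) alike₄ xy =
      no-three-resolved y≢w (≢-sym v≢y) (≢-sym v≢w)
        (adjacency-resolves x≢y x≢w x≢v x≢y x≢w (λ e → true≢false (sym xy ⨾ e ⨾ ¬xw)))
        (adjacency-resolves (≢-sym y≢z) z≢w z≢v (≢-sym y≢z) z≢v
          (λ e → true≢false (sym vz ⨾ sym-G v z ⨾ sym e ⨾ sym-G z y ⨾ ¬yz)))
        (adjacency-resolves x≢y x≢w x≢v x≢w x≢v (λ e → true≢false (sym vx ⨾ sym-G v x ⨾ sym e ⨾ ¬xw)))
      where
      ¬xw : G x w ≡ false
      ¬xw = differs-from-true differ₃ (sym (alike₄ x x≢y x≢z x≢w) ⨾ xy)
      ¬yw : G y w ≡ false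
      ¬yw = differs-from-true differ₂ (sym-G y x ⨾ xy)
      ¬yz : G y z ≡ false
      ¬yz = alike₃ y y≢z y≢w (≢-sym x≢y) ⨾ ¬yw
      common = diameter-two y≢w ¬yw
      v = proj₁ common
      yv = proj₁ (proj₂ common)
      vw = proj₂ (proj₂ common)
      v≢y : v ≢ y
      v≢y v≡y = true≢false (sym yv ⨾ cong (G y) v≡y ⨾ irrefl-G y)
      v≢w : v ≢ w
      v≢w v≡w = true≢false (sym vw ⨾ cong (λ t → G t w) v≡w ⨾ irrefl-G w)
      x≢v : x ≢ v
      x≢v x≡v = true≢false (sym vw ⨾ cong (λ t → G t w) (sym x≡v) ⨾ ¬xw)
      z≢v : z ≢ v
      z≢v z≡v = true≢false (sym yv ⨾ cong (G y) (sym z≡v) ⨾ ¬yz)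
      vx : G v x ≡ true
      vx = alike₁ v (≢-sym x≢v) v≢y (≢-sym z≢v) ⨾ sym-G v y ⨾ yv
      vz : G v z ≡ true
      vz = alike₃ v (≢-sym z≢v) v≢w (≢-sym x≢v) ⨾ vw

    path-configuration-non-adjacent : ∀ {x y z w} → x ≢ y → x ≢ z → x ≢ w → y ≢ z → y ≢ w → z ≢ w →
      SeparatedOnlyBy x y z → SeparatedOnlyBy x w y → SeparatedOnlyBy z w x → AlikeOutside G y z w →
      G x y ≡ false → ⊥
    path-configuration-non-adjacent {x} {y} {z} {w} x≢y x≢z x≢w y≢z y≢w z≢w
      (alike₁ , _) (alike₂ , _) (_ , differ₃) alike₄ ¬xy =
      no-three-resolved x≢z (≢-sym v≢x) (≢-sym v≢z)
        (adjacency-resolves (≢-sym x≢w) (≢-sym z≢w) w≢v (≢-sym x≢w) (≢-sym z≢w)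
          (λ e → true≢false (sym (sym-G w x ⨾ xw) ⨾ e ⨾ sym-G w z ⨾ ¬zw)))
        (adjacency-resolves (≢-sym x≢y) y≢z y≢v (≢-sym x≢y) y≢v
          (λ e → true≢false (sym vy ⨾ sym-G v y ⨾ sym e ⨾ sym-G y x ⨾ ¬xy)))
        (adjacency-resolves (≢-sym x≢w) (≢-sym z≢w) w≢v (≢-sym z≢w) w≢v
          (λ e → true≢false (sym vw ⨾ sym-G v w ⨾ sym e ⨾ sym-G w z ⨾ ¬zw)))
      where
      ¬xz : G x z ≡ false
      ¬xz = sym (alike₄ x x≢y x≢z x≢w) ⨾ ¬xy
      xw : G x w ≡ true
      xw = differs-from-false differ₃ ¬xz
      ¬zw : G z w ≡ false
      ¬zw = sym (alike₂ z (≢-sym x≢z) z≢w (≢-sym y≢z)) ⨾ sym-G z x ⨾ ¬xz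
      common = diameter-two x≢z ¬xz
      v = proj₁ common
      xv = proj₁ (proj₂ common)
      vz = proj₂ (proj₂ common)
      v≢x : v ≢ x
      v≢x v≡x = true≢false (sym xv ⨾ cong (G x) v≡x ⨾ irrefl-G x)
      v≢z : v ≢ z
      v≢z v≡z = true≢false (sym vz ⨾ cong (λ t → G t z) v≡z ⨾ irrefl-G z)
      y≢v : y ≢ v
      y≢v y≡v = true≢false (sym xv ⨾ cong (G x) (sym y≡v) ⨾ ¬xy)
      w≢v : w ≢ v
      w≢v w≡v = true≢false (sym vz ⨾ cong (λ t → G t z) (sym w≡v) ⨾ sym-G w z ⨾ ¬zw)
      vx : G v x ≡ true
      vx = sym-G v x ⨾ xv
      vw : G v w ≡ true
      vw = sym (alike₂ v v≢x (≢-sym w≢v) (≢-sym y≢v)) ⨾ vx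
      vy : G v y ≡ true
      vy = sym (alike₁ v v≢x (≢-sym y≢v) v≢z) ⨾ vx

    -- Each of the triples x z w and y z w has a sole separator; every combination but the path
    -- configuration contradicts a given separation or the uniqueness of sole separators.
    chained-separations : ∀ {x y z w} → ¬ Twin G x y → ¬ Twin G x z → ¬ Twin G x w →
      ¬ Twin G y z → ¬ Twin G y w → ¬ Twin G z w →
      SeparatedOnlyBy x y z → SeparatedOnlyBy x w y → ⊥
    chained-separations {x} {y} {z} {w} ¬xy ¬xz ¬xw ¬yz ¬yw ¬zw sep₁@(alike₁ , differ₁) sep₂@(alike₂ , differ₂) =
      cases (three-non-twins ¬xz ¬xw ¬zw) (three-non-twins ¬yz ¬yw ¬zw)
      where
      x≢y = ¬Twin⇒≢ ¬xy ; x≢z = ¬Twin⇒≢ ¬xz ; x≢w = ¬Twin⇒≢ ¬xw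
      y≢z = ¬Twin⇒≢ ¬yz ; y≢w = ¬Twin⇒≢ ¬yw ; z≢w = ¬Twin⇒≢ ¬zw
      cases : SeparatedOnlyBy x z w ⊎ SeparatedOnlyBy x w z ⊎ SeparatedOnlyBy z w x →
              SeparatedOnlyBy y z w ⊎ SeparatedOnlyBy y w z ⊎ SeparatedOnlyBy z w y → ⊥
      cases (inj₂ (inj₁ sep)) _ = SeparatedOnlyBy-unique sep₂ sep (≢-sym x≢z) z≢w (≢-sym y≢z)
      cases _ (inj₂ (inj₁ (alike₄ , _))) =
        differ₂ (sym-G y x ⨾ alike₄ x x≢y x≢w x≢z ⨾ sym-G x w ⨾ alike₁ w (≢-sym x≢w) (≢-sym y≢w) (≢-sym z≢w) ⨾ sym-G w y)
      cases (inj₁ (alike₃ , _)) (inj₁ (alike₄ , _)) =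
        differ₁ (sym-G z x ⨾ sym (alike₄ x x≢y x≢z x≢w) ⨾ sym-G x y ⨾ alike₃ y (≢-sym x≢y) y≢z y≢w ⨾ sym-G y z)
      cases (inj₁ (_ , differ₃)) (inj₂ (inj₂ (alike₄ , _))) =
        differ₃ (sym-G w x ⨾ sym (alike₄ x x≢z x≢w x≢y) ⨾ sym-G x z ⨾ alike₂ z (≢-sym x≢z) z≢w (≢-sym y≢z) ⨾ sym-G z w)
      cases (inj₂ (inj₂ sep₃)) (inj₂ (inj₂ sep₄)) = SeparatedOnlyBy-unique sep₃ sep₄ y≢z y≢w (≢-sym x≢y)
      cases (inj₂ (inj₂ sep₃)) (inj₁ (alike₄ , _)) with G x y in xy
      ... | true = path-configuration-adjacent x≢y x≢z x≢w y≢z y≢w z≢w sep₁ sep₂ sep₃ alike₄ xy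
      ... | false = path-configuration-non-adjacent x≢y x≢z x≢w y≢z y≢w z≢w sep₁ sep₂ sep₃ alike₄ xy

  no-four-non-twins : ∀ {x y z w} → ¬ Twin G x y → ¬ Twin G x z → ¬ Twin G x w →
    ¬ Twin G y z → ¬ Twin G y w → ¬ Twin G z w → ⊥
  no-four-non-twins {x} {y} {z} {w} ¬xy ¬xz ¬xw ¬yz ¬yw ¬zw = cases (three-non-twins ¬xy ¬xz ¬yz)
    where
    ¬yx : ¬ Twin G y x
    ¬yx = ¬xy ∘ Twin-sym
    ¬zx : ¬ Twin G z x
    ¬zx = ¬xz ∘ Twin-sym
    ¬zy : ¬ Twin G z y
    ¬zy = ¬yz ∘ Twin-sym
    second : ∀ {p q r} → SeparatedOnlyBy p q r → SeparatedOnlyBy p q w →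
      ¬ Twin G p w → ¬ Twin G q w → ¬ Twin G r w → ⊥
    second sep sep′ ¬pw ¬qw ¬rw =
      SeparatedOnlyBy-unique sep sep′ (≢-sym (¬Twin⇒≢ ¬pw)) (≢-sym (¬Twin⇒≢ ¬qw)) (≢-sym (¬Twin⇒≢ ¬rw))
    cases : SeparatedOnlyBy x y z ⊎ SeparatedOnlyBy x z y ⊎ SeparatedOnlyBy y z x → ⊥
    cases (inj₁ sep) with three-non-twins ¬xy ¬xw ¬yw
    ... | inj₁ sep′ = second sep sep′ ¬xw ¬yw ¬zw
    ... | inj₂ (inj₁ sep′) = chained-separations ¬xy ¬xz ¬xw ¬yz ¬yw ¬zw sep sep′
    ... | inj₂ (inj₂ sep′) = chained-separations ¬yx ¬yz ¬yw ¬xz ¬xw ¬zw (SeparatedOnlyBy-swap sep) sep′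
    cases (inj₂ (inj₁ sep)) with three-non-twins ¬xz ¬xw ¬zw
    ... | inj₁ sep′ = second sep sep′ ¬xw ¬zw ¬yw
    ... | inj₂ (inj₁ sep′) = chained-separations ¬xz ¬xy ¬xw ¬zy ¬zw ¬yw sep sep′
    ... | inj₂ (inj₂ sep′) = chained-separations ¬zx ¬zy ¬zw ¬xy ¬xw ¬yw (SeparatedOnlyBy-swap sep) sep′
    cases (inj₂ (inj₂ sep)) with three-non-twins ¬yz ¬yw ¬zw
    ... | inj₁ sep′ = second sep sep′ ¬yw ¬zw ¬xw
    ... | inj₂ (inj₁ sep′) = chained-separations ¬yz ¬yx ¬yw ¬zx ¬zw ¬xw sep sep′
    ... | inj₂ (inj₂ sep′) = chained-separations ¬zy ¬zx ¬zw ¬yx ¬yw ¬xw (SeparatedOnlyBy-swap sep) sep′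

  TwinOf : Fin n → Fin n → Bool
  TwinOf x u = does (twin? x u)

  class-uniform : ∀ {r u v u′ v′} → Twin G r u → Twin G r v → Twin G r u′ → Twin G r v′ →
    u ≢ v → u′ ≢ v′ → G u v ≡ G u′ v′
  class-uniform {r} {u} {v} {u′} {v′} ru rv ru′ rv′ u≢v u′≢v′ with v′ ≟ u
  ... | no v′≢u = Twin-trans (Twin-sym rv) rv′ u u≢v (≢-sym v′≢u)
                  ⨾ Twin-adjacency (Twin-trans (Twin-sym ru) ru′) v′≢u (≢-sym u′≢v′)
  ... | yes refl = Twin-trans (Twin-sym rv) ru′ u u≢v (≢-sym u′≢v′) ⨾ sym-G u u′

  cross-adjacency : ∀ {x y u v} → ¬ Twin G x y → Twin G x u → Twin G y v → G u v ≡ G x y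
  cross-adjacency {x} {y} {u} {v} ¬xy xu yv =
    Twin-adjacency (Twin-sym xu) v≢u v≢x ⨾ sym-G x v
    ⨾ Twin-adjacency (Twin-sym yv) (≢-sym v≢x) (¬Twin⇒≢ ¬xy) ⨾ sym-G y x
    where
    v≢u : v ≢ u
    v≢u refl = ¬xy (Twin-trans xu (Twin-sym yv))
    v≢x : v ≢ x
    v≢x refl = ¬xy (Twin-sym yv)

  HasEdge : (Fin n → Set) → Set
  HasEdge C = ∃₂ λ u v → C u × C v × u ≢ v × G u v ≡ true

  hasEdge? : ∀ r → Dec (HasEdge (Twin G r))
  hasEdge? r with any? (λ u → any? (λ v → twin? r u ×-dec twin? r v ×-dec ¬? (u ≟ v) ×-dec (G u v ≟ᵇ true)))
  ... | yes (u , v , edge) = yes (u , v , edge)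
  ... | no none = no λ { (u , v , edge) → none (u , v , edge) }

  class-independent : ∀ {r} → ¬ HasEdge (Twin G r) → ∀ {u v} → Twin G r u → Twin G r v → G u v ≡ false
  class-independent {r} ¬edge {u} {v} ru rv with u ≟ v
  ... | yes refl = irrefl-G u
  ... | no u≢v with G u v in uv
  ...   | false = refl
  ...   | true = contradiction (u , v , ru , rv , u≢v , uv) ¬edge

  class-clique : ∀ {r} → HasEdge (Twin G r) → ∀ {u v} → Twin G r u → Twin G r v → u ≢ v → G u v ≡ true
  class-clique (u₀ , v₀ , ru₀ , rv₀ , u₀≢v₀ , u₀v₀) ru rv u≢v =
    class-uniform ru rv ru₀ rv₀ u≢v u₀≢v₀ ⨾ u₀v₀

  module TwoClasses (x y : Fin n) (¬xy : ¬ Twin G x y) (classes : ∀ w → Twin G x w ⊎ Twin G y w) where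

    -- A common neighbour of non-adjacent x and y would lie in one of the two classes.
    adjacent : G x y ≡ true
    adjacent with G x y in xy
    ... | true = refl
    ... | false with diameter-two (¬Twin⇒≢ ¬xy) xy
    ...   | w , xw , wy with classes w
    ...     | inj₁ x~w = contradiction (sym wy ⨾ cross-adjacency ¬xy x~w Twin-refl ⨾ xy) true≢false
    ...     | inj₂ y~w = contradiction (sym xw ⨾ cross-adjacency ¬xy Twin-refl y~w ⨾ xy) true≢false

    y-class : ∀ {u} → TwinOf x u ≡ false → Twin G y u
    y-class {u} ¬x~u with classes u
    ... | inj₁ x~u = contradiction x~u (does-false (twin? x u) ¬x~u)
    ... | inj₂ y~u = y~u

    across : ∀ {u v} → Twin G x u → Twin G y v → G u v ≡ true
    across x~u y~v = cross-adjacency ¬xy x~u y~v ⨾ adjacent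

    clique+independent : HasEdge (Twin G x) → ¬ HasEdge (Twin G y) → Shape G
    clique+independent x-edge ¬y-edge = K+Kbar-shape (TwinOf x) universal independent two-outside
      where
      universal : ∀ u v → u ≢ v → TwinOf x u ≡ true → G u v ≡ true
      universal u v u≢v x~u with classes v
      ... | inj₁ x~v = class-clique x-edge (does-true (twin? x u) x~u) x~v u≢v
      ... | inj₂ y~v = across (does-true (twin? x u) x~u) y~v
      independent : ∀ u v → TwinOf x u ≡ false → TwinOf x v ≡ false → G u v ≡ false
      independent u v ¬x~u ¬x~v = class-independent ¬y-edge (y-class ¬x~u) (y-class ¬x~v)
      outside-x : ∀ {u v} → u ≢ v → G u v ≡ false → TwinOf x u ≡ false
      outside-x {u} {v} u≢v ¬uv with TwinOf x u in x~u
      ... | false = refl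
      ... | true = contradiction (sym (universal u v u≢v x~u) ⨾ ¬uv) true≢false
      two-outside : ∃₂ λ v₁ v₂ → v₁ ≢ v₂ × TwinOf x v₁ ≡ false × TwinOf x v₂ ≡ false
      two-outside with not-complete
      ... | u , v , u≢v , ¬uv = u , v , u≢v , outside-x u≢v ¬uv , outside-x (≢-sym u≢v) (sym-G v u ⨾ ¬uv)

  two-classes : ∀ x y → ¬ Twin G x y → (∀ w → Twin G x w ⊎ Twin G y w) → Shape G
  two-classes x y ¬xy classes with hasEdge? x | hasEdge? y
  ... | yes x-edge | no ¬y-edge = TwoClasses.clique+independent x y ¬xy classes x-edge ¬y-edge
  ... | no ¬x-edge | yes y-edge = TwoClasses.clique+independent y x (¬xy ∘ Twin-sym) (swap ∘ classes) y-edge ¬x-edge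
  ... | no ¬x-edge | no ¬y-edge = Kbip-shape (TwinOf x) same-side different-sides
    where
    open TwoClasses x y ¬xy classes
    same-side : ∀ u v → TwinOf x u ≡ TwinOf x v → G u v ≡ false
    same-side u v same with TwinOf x u in x~u | TwinOf x v in x~v
    ... | true  | true  = class-independent ¬x-edge (does-true (twin? x u) x~u) (does-true (twin? x v) x~v)
    ... | false | false = class-independent ¬y-edge (y-class x~u) (y-class x~v)
    ... | true  | false = contradiction same true≢false
    ... | false | true  = contradiction (sym same) true≢false
    different-sides : ∀ u v → TwinOf x u ≢ TwinOf x v → G u v ≡ true
    different-sides u v differ with TwinOf x u in x~u | TwinOf x v in x~v
    ... | true  | true  = contradiction refl differ
    ... | false | false = contradiction refl differ
    ... | true  | false = across (does-true (twin? x u) x~u) (y-class x~v)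
    ... | false | true  = sym-G u v ⨾ across (does-true (twin? x v) x~v) (y-class x~u)
  ... | yes x-edge | yes y-edge with not-complete
  ...   | u , v , u≢v , ¬uv = contradiction (sym complete ⨾ ¬uv) true≢false
    where
    open TwoClasses x y ¬xy classes
    complete : G u v ≡ true
    complete with classes u | classes v
    ... | inj₁ x~u | inj₁ x~v = class-clique x-edge x~u x~v u≢v
    ... | inj₂ y~u | inj₂ y~v = class-clique y-edge y~u y~v u≢v
    ... | inj₁ x~u | inj₂ y~v = across x~u y~v
    ... | inj₂ y~u | inj₁ x~v = sym-G u v ⨾ across x~v y~u

  -- r then forms a class of its own, P ∪ Q is a clique, and r is joined exactly to P.
  module ThreeClasses (p q r : Fin n) (¬pq : ¬ Twin G p q) (¬pr : ¬ Twin G p r) (¬qr : ¬ Twin G q r)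
    (classes : ∀ w → Twin G p w ⊎ Twin G q w ⊎ Twin G r w)
    (separated : SeparatedOnlyBy p q r) (rp : G r p ≡ true) where

    private
      alike = proj₁ separated
      p≢q = ¬Twin⇒≢ ¬pq
      p≢r = ¬Twin⇒≢ ¬pr
      q≢r = ¬Twin⇒≢ ¬qr

    ¬rq : G r q ≡ false
    ¬rq = differs-from-true (proj₂ separated) rp

    P∪Q : Fin n → Set
    P∪Q w = Twin G p w ⊎ Twin G q w

    ≢r : ∀ {u} → P∪Q u → u ≢ r
    ≢r (inj₁ p~u) refl = ¬pr p~u
    ≢r (inj₂ q~u) refl = ¬qr q~u

    r-alone : ∀ {w} → Twin G r w → w ≡ r
    r-alone {w} r~w with w ≟ r
    ... | yes w≡r = w≡r
    ... | no w≢r = contradiction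
          (Twin-adjacency r~w p≢r (≢-sym w≢p) ⨾ alike w w≢p w≢q w≢r ⨾ sym (Twin-adjacency r~w q≢r (≢-sym w≢q)))
          (proj₂ separated)
      where
      w≢p : w ≢ p
      w≢p refl = ¬pr (Twin-sym r~w)
      w≢q : w ≢ q
      w≢q refl = ¬qr (Twin-sym r~w)

    P∪Q-except-r : ∀ {w} → w ≢ r → P∪Q w
    P∪Q-except-r {w} w≢r with classes w
    ... | inj₁ p~w = inj₁ p~w
    ... | inj₂ (inj₁ q~w) = inj₂ q~w
    ... | inj₂ (inj₂ r~w) = contradiction (r-alone r~w) w≢r

    to-p : ∀ {w} → P∪Q w → w ≢ p → G w p ≡ G p q
    to-p (inj₂ q~w) w≢p = sym-G _ p ⨾ cross-adjacency ¬pq Twin-refl q~w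
    to-p {w} (inj₁ p~w) w≢p = alike w w≢p (λ w≡q → ¬pq (subst (Twin G p) w≡q p~w)) (≢r (inj₁ p~w))
                              ⨾ cross-adjacency ¬pq p~w Twin-refl

    to-q : ∀ {w} → P∪Q w → w ≢ q → G w q ≡ G p q
    to-q (inj₁ p~w) w≢q = cross-adjacency ¬pq p~w Twin-refl
    to-q {w} (inj₂ q~w) w≢q = sym (alike w w≢p w≢q (≢r (inj₂ q~w))) ⨾ sym-G w p ⨾ cross-adjacency ¬pq Twin-refl q~w
      where
      w≢p : w ≢ p
      w≢p refl = ¬pq (Twin-sym q~w)

    within : ∀ {u v} → P∪Q u → P∪Q v → u ≢ v → G u v ≡ G p q
    within {u} {v} Pu Pv u≢v with u ≟ p | v ≟ p
    ... | yes refl | _ = sym-G p v ⨾ to-p Pv (≢-sym u≢v)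
    ... | no u≢p | yes refl = to-p Pu u≢p
    ... | no u≢p | no v≢p with Pu | Pv
    ...   | inj₁ p~u | _ = Twin-adjacency (Twin-sym p~u) (≢-sym u≢v) v≢p ⨾ sym-G p v ⨾ to-p Pv v≢p
    ...   | inj₂ q~u | inj₁ p~v = sym-G u v ⨾ Twin-adjacency (Twin-sym p~v) u≢v u≢p ⨾ sym-G p u ⨾ to-p Pu u≢p
    ...   | inj₂ q~u | inj₂ q~v with v ≟ q
    ...     | yes refl = to-q Pu u≢v
    ...     | no v≢q = Twin-adjacency (Twin-sym q~u) (≢-sym u≢v) v≢q ⨾ sym-G q v ⨾ to-q Pv v≢q

    P-to-r : ∀ {u} → Twin G p u → G u r ≡ true
    P-to-r p~u = Twin-adjacency (Twin-sym p~u) (≢-sym (≢r (inj₁ p~u))) (≢-sym p≢r) ⨾ sym-G p r ⨾ rp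

    Q-to-r : ∀ {u} → Twin G q u → G u r ≡ false
    Q-to-r q~u = Twin-adjacency (Twin-sym q~u) (≢-sym (≢r (inj₂ q~u))) (≢-sym q≢r) ⨾ sym-G q r ⨾ ¬rq

    -- A common neighbour of q and r would be joined to q unlike the pattern pq.
    pq-adjacent : G p q ≡ true
    pq-adjacent with G p q in pq
    ... | true = refl
    ... | false with diameter-two q≢r (sym-G q r ⨾ ¬rq)
    ...   | w , qw , _ with w ≟ r
    ...     | yes refl = contradiction (sym qw ⨾ sym-G q r ⨾ ¬rq) true≢false
    ...     | no w≢r with w ≟ q
    ...       | yes refl = contradiction (sym qw ⨾ irrefl-G q) true≢false
    ...       | no w≢q = contradiction (sym qw ⨾ within (inj₂ Twin-refl) (P∪Q-except-r w≢r) (≢-sym w≢q) ⨾ pq) true≢false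

    shape : Shape G
    shape = K+[K∪K₁]-shape (TwinOf p) r (dec-false (twin? p r) ¬pr) clique marked-to-r unmarked-to-r two-in-Q
      where
      clique : ∀ u v → u ≢ v → u ≢ r → v ≢ r → G u v ≡ true
      clique u v u≢v u≢r v≢r = within (P∪Q-except-r u≢r) (P∪Q-except-r v≢r) u≢v ⨾ pq-adjacent
      marked-to-r : ∀ u → TwinOf p u ≡ true → G u r ≡ true
      marked-to-r u p~u = P-to-r (does-true (twin? p u) p~u)
      unmarked-to-r : ∀ u → TwinOf p u ≡ false → G u r ≡ false
      unmarked-to-r u ¬p~u with u ≟ r
      ... | yes refl = irrefl-G r
      ... | no u≢r with P∪Q-except-r u≢r
      ...   | inj₁ p~u = contradiction p~u (does-false (twin? p u) ¬p~u)
      ...   | inj₂ q~u = Q-to-r q~u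
      -- If q had no twin, r would be a twin of q.
      two-in-Q : ∃₂ λ v₁ v₂ → v₁ ≢ v₂ × TwinOf p v₁ ≡ false × TwinOf p v₂ ≡ false × v₁ ≢ r × v₂ ≢ r
      two-in-Q with any? (λ w → twin? q w ×-dec ¬? (w ≟ q))
      ... | yes (w , q~w , w≢q) =
            q , w , ≢-sym w≢q , dec-false (twin? p q) ¬pq ,
            dec-false (twin? p w) (λ p~w → ¬pq (Twin-trans p~w (Twin-sym q~w))) , q≢r , ≢r (inj₂ q~w)
      ... | no ¬twin = contradiction q~r ¬qr
        where
        q~r : Twin G q r
        q~r w w≢q w≢r with P∪Q-except-r w≢r
        ... | inj₁ p~w = to-q (inj₁ p~w) w≢q ⨾ pq-adjacent ⨾ sym (P-to-r p~w)
        ... | inj₂ q~w = contradiction (w , q~w , w≢q) ¬twin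

  three-classes : ∀ p q r → ¬ Twin G p q → ¬ Twin G p r → ¬ Twin G q r →
    (∀ w → Twin G p w ⊎ Twin G q w ⊎ Twin G r w) → SeparatedOnlyBy p q r → Shape G
  three-classes p q r ¬pq ¬pr ¬qr classes separated = oriented (G r p) refl
    where
    classes′ : ∀ w → Twin G q w ⊎ Twin G p w ⊎ Twin G r w
    classes′ w with classes w
    ... | inj₁ p~w = inj₂ (inj₁ p~w)
    ... | inj₂ (inj₁ q~w) = inj₁ q~w
    ... | inj₂ (inj₂ r~w) = inj₂ (inj₂ r~w)
    oriented : ∀ b → G r p ≡ b → Shape G
    oriented true rp = ThreeClasses.shape p q r ¬pq ¬pr ¬qr classes separated rp
    oriented false rp = ThreeClasses.shape q p r (¬pq ∘ Twin-sym) ¬qr ¬pr classes′ (SeparatedOnlyBy-swap separated)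
                          (differs-from-false (proj₂ separated) rp)

  three-non-twins-cover : ∀ {x y z} → ¬ Twin G x y → ¬ Twin G x z → ¬ Twin G y z →
    ∀ w → Twin G x w ⊎ Twin G y w ⊎ Twin G z w
  three-non-twins-cover {x} {y} {z} ¬xy ¬xz ¬yz w with twin? x w | twin? y w | twin? z w
  ... | yes x~w | _ | _ = inj₁ x~w
  ... | no _ | yes y~w | _ = inj₂ (inj₁ y~w)
  ... | no _ | no _ | yes z~w = inj₂ (inj₂ z~w)
  ... | no ¬xw | no ¬yw | no ¬zw = ⊥-elim (no-four-non-twins ¬xy ¬xz ¬xw ¬yz ¬yw ¬zw)

  -- A common neighbour w of a non-adjacent pair u, v cannot be a twin of v.
  not-all-twins : ¬ (∀ y → Twin G x₀ y)
  not-all-twins all-twins with not-complete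
  ... | u , v , u≢v , ¬uv with diameter-two u≢v ¬uv
  ...   | w , uw , _ = true≢false (sym uw ⨾ Twin-trans (Twin-sym (all-twins w)) (all-twins v) u u≢w u≢v ⨾ ¬uv)
    where
    u≢w : u ≢ w
    u≢w u≡w = true≢false (sym uw ⨾ cong (G u) (sym u≡w) ⨾ irrefl-G u)

  structure : Shape G
  structure with any? (λ y → ¬? (twin? x₀ y))
  ... | no none = contradiction (λ y → decidable-stable (twin? x₀ y) (λ ¬twin → none (y , ¬twin))) not-all-twins
  ... | yes (y₀ , ¬x₀y₀) with any? (λ z → ¬? (twin? x₀ z) ×-dec ¬? (twin? y₀ z))
  ...   | no two = two-classes x₀ y₀ ¬x₀y₀ classes
    where
    classes : ∀ w → Twin G x₀ w ⊎ Twin G y₀ w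
    classes w with twin? x₀ w | twin? y₀ w
    ... | yes x₀~w | _ = inj₁ x₀~w
    ... | no _ | yes y₀~w = inj₂ y₀~w
    ... | no ¬x₀w | no ¬y₀w = contradiction (w , ¬x₀w , ¬y₀w) two
  ...   | yes (z₀ , ¬x₀z₀ , ¬y₀z₀) with three-non-twins ¬x₀y₀ ¬x₀z₀ ¬y₀z₀
  ...     | inj₁ sep = three-classes x₀ y₀ z₀ ¬x₀y₀ ¬x₀z₀ ¬y₀z₀
                         (three-non-twins-cover ¬x₀y₀ ¬x₀z₀ ¬y₀z₀) sep
  ...     | inj₂ (inj₁ sep) = three-classes x₀ z₀ y₀ ¬x₀z₀ ¬x₀y₀ (¬y₀z₀ ∘ Twin-sym)
                                (three-non-twins-cover ¬x₀z₀ ¬x₀y₀ (¬y₀z₀ ∘ Twin-sym)) sep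
  ...     | inj₂ (inj₂ sep) = three-classes y₀ z₀ x₀ ¬y₀z₀ (¬x₀y₀ ∘ Twin-sym) (¬x₀z₀ ∘ Twin-sym)
                                (three-non-twins-cover ¬y₀z₀ (¬x₀y₀ ∘ Twin-sym) (¬x₀z₀ ∘ Twin-sym)) sep

-- Partitions of the vertex set

record Partition {n} (L R : Fin n → Set) : Set where
  field
    #L #R : ℕ
    classify : Fin n → Fin #L ⊎ Fin #R
    element : Fin #L ⊎ Fin #R → Fin n
    classify-element : ∀ x → classify (element x) ≡ x
    element-classify : ∀ u → element (classify u) ≡ u
    element-L : ∀ x → L (element (inj₁ x))
    element-R : ∀ x → R (element (inj₂ x))

  element-injective : ∀ {x y} → element x ≡ element y → x ≡ y
  element-injective {x} {y} same = sym (classify-element x) ⨾ cong classify same ⨾ classify-element y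

  element-injectiveˡ : ∀ {i j} → element (inj₁ i) ≡ element (inj₁ j) → i ≡ j
  element-injectiveˡ = inj₁-injective ∘ element-injective

  element-injectiveʳ : ∀ {i j} → element (inj₂ i) ≡ element (inj₂ j) → i ≡ j
  element-injectiveʳ = inj₂-injective ∘ element-injective

  locateʳ : ∀ {w} → ¬ L w → ∃ λ j → element (inj₂ j) ≡ w
  locateʳ {w} ¬Lw with classify w in cw
  ... | inj₁ i = contradiction (subst L (cong element (sym cw) ⨾ element-classify w) (element-L i)) ¬Lw
  ... | inj₂ j = j , cong element (sym cw) ⨾ element-classify w

  locateˡ : ∀ {w} → ¬ R w → ∃ λ i → element (inj₁ i) ≡ w
  locateˡ {w} ¬Rw with classify w in cw
  ... | inj₁ i = i , cong element (sym cw) ⨾ element-classify w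
  ... | inj₂ j = contradiction (subst R (cong element (sym cw) ⨾ element-classify w) (element-R j)) ¬Rw

  ↔Fin : Fin n ↔ Fin (#L + #R)
  ↔Fin = mk↔ₛ′ (λ u → join #L #R (classify u)) (λ w → element (splitAt #L w))
    (λ w → cong (join #L #R) (classify-element _) ⨾ join-splitAt #L #R w)
    (λ u → cong element (splitAt-join #L #R (classify u)) ⨾ element-classify u)

open Partition

Partition-swap : ∀ {n} {L R : Fin n → Set} → Partition L R → Partition R L
Partition-swap π = record
  { #L = #R π ; #R = #L π
  ; classify = λ u → swap (classify π u)
  ; element = λ x → element π (swap x)
  ; classify-element = λ x → cong swap (classify-element π (swap x)) ⨾ swap-involutive x
  ; element-classify = λ u → cong (element π) (swap-involutive (classify π u)) ⨾ element-classify π u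
  ; element-L = element-R π
  ; element-R = element-L π
  }

Partition-consˡ : ∀ {n} {L R : Fin (suc n) → Set} → L 0F →
  Partition (λ u → L (1+ u)) (λ u → R (1+ u)) → Partition L R
Partition-consˡ {L = L} {R} L0 π = record
  { #L = suc (#L π) ; #R = #R π
  ; classify = classify′ ; element = element′
  ; classify-element = classify-element′ ; element-classify = element-classify′
  ; element-L = element-L′ ; element-R = element-R π
  }
  where
  classify′ : Fin _ → Fin (suc (#L π)) ⊎ Fin (#R π)
  classify′ 0F = inj₁ 0F
  classify′ (1+ u) = map₁ 1+ (classify π u)
  element′ : Fin (suc (#L π)) ⊎ Fin (#R π) → Fin _
  element′ (inj₁ 0F) = 0F
  element′ (inj₁ (1+ i)) = 1+ (element π (inj₁ i))
  element′ (inj₂ j) = 1+ (element π (inj₂ j))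
  classify-element′ : ∀ x → classify′ (element′ x) ≡ x
  classify-element′ (inj₁ 0F) = refl
  classify-element′ (inj₁ (1+ i)) = cong (map₁ 1+) (classify-element π (inj₁ i))
  classify-element′ (inj₂ j) = cong (map₁ 1+) (classify-element π (inj₂ j))
  element-classify′ : ∀ u → element′ (classify′ u) ≡ u
  element-classify′ 0F = refl
  element-classify′ (1+ u) with classify π u | element-classify π u
  ... | inj₁ i | e = cong 1+ e
  ... | inj₂ j | e = cong 1+ e
  element-L′ : ∀ x → L (element′ (inj₁ x))
  element-L′ 0F = L0
  element-L′ (1+ i) = element-L π i

partition : ∀ {n} {P : Fin n → Set} → Decidable P → Partition P (λ u → ¬ P u)
partition {zero} P? = record
  { #L = 0 ; #R = 0
  ; classify = λ () ; element = λ { (inj₁ ()) ; (inj₂ ()) }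
  ; classify-element = λ { (inj₁ ()) ; (inj₂ ()) } ; element-classify = λ ()
  ; element-L = λ () ; element-R = λ ()
  }
partition {suc n} P? with P? 0F
... | yes p = Partition-consˡ p (partition (λ u → P? (1+ u)))
... | no ¬p = Partition-swap (Partition-consˡ ¬p (Partition-swap (partition (λ u → P? (1+ u)))))

Partition-reindexʳ : ∀ {n m} {L R : Fin n → Set} (π : Partition L R) → Fin (#R π) ↔ Fin m → Partition L R
Partition-reindexʳ π g = record
  { #L = #L π ; #R = _
  ; classify = λ u → map₂ (to g) (classify π u)
  ; element = λ x → element π (map₂ (from g) x)
  ; classify-element = λ x → cong (map₂ (to g)) (classify-element π _) ⨾ map₂-inverse x
  ; element-classify = λ u → cong (element π) (map₂-inverse′ (classify π u)) ⨾ element-classify π u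
  ; element-L = element-L π
  ; element-R = λ x → element-R π (from g x)
  }
  where
  map₂-inverse : ∀ {A : Set} (x : A ⊎ Fin _) → map₂ (to g) (map₂ (from g) x) ≡ x
  map₂-inverse (inj₁ i) = refl
  map₂-inverse (inj₂ k) = cong inj₂ (strictlyInverseˡ g k)
  map₂-inverse′ : ∀ {A : Set} (x : A ⊎ Fin _) → map₂ (from g) (map₂ (to g) x) ≡ x
  map₂-inverse′ (inj₁ i) = refl
  map₂-inverse′ (inj₂ j) = cong inj₂ (strictlyInverseʳ g j)

≅-combine : ∀ {n} {G : Adj n} {L R : Fin n → Set} (π : Partition L R)
  (cross : Bool) (H₁ : Adj (#L π)) (H₂ : Adj (#R π)) →
  (∀ i j → G (element π (inj₁ i)) (element π (inj₁ j)) ≡ H₁ i j) →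
  (∀ i j → G (element π (inj₁ i)) (element π (inj₂ j)) ≡ cross) →
  (∀ j i → G (element π (inj₂ j)) (element π (inj₁ i)) ≡ cross) →
  (∀ i j → G (element π (inj₂ i)) (element π (inj₂ j)) ≡ H₂ i j) →
  G ≅ combine cross H₁ H₂
≅-combine {G = G} π cross H₁ H₂ ll lr rl rr =
  ↔Fin π , λ u v → cong₂ G (sym (element-classify π u)) (sym (element-classify π v)) ⨾ blocks (classify π u) (classify π v)
  where
  blocks : ∀ x y → G (element π x) (element π y) ≡ combine cross H₁ H₂ (join _ _ x) (join _ _ y)
  blocks (inj₁ i) (inj₁ j) = ll i j ⨾ sym (combine-ˡˡ cross H₁ H₂ i j)
  blocks (inj₁ i) (inj₂ j) = lr i j ⨾ sym (combine-ˡʳ cross H₁ H₂ i j)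
  blocks (inj₂ j) (inj₁ i) = rl j i ⨾ sym (combine-ʳˡ cross H₁ H₂ j i)
  blocks (inj₂ i) (inj₂ j) = rr i j ⨾ sym (combine-ʳʳ cross H₁ H₂ i j)

Fin-singleton : ∀ {m} → Fin m → (∀ (x y : Fin m) → x ≡ y) → m ≡ 1
Fin-singleton {suc zero} _ _ = refl
Fin-singleton {suc (suc m)} _ all-equal with all-equal 0F (1+ 0F)
... | ()

#R≡1 : ∀ {n} {L R : Fin n → Set} (π : Partition L R) → (∀ {u v} → R u → R v → u ≡ v) →
  ∀ {w} → ¬ L w → #R π ≡ 1
#R≡1 π unique ¬Lw with locateʳ π ¬Lw
... | j , _ = Fin-singleton j (λ x y → element-injectiveʳ π (unique (element-R π x) (element-R π y)))

sides : ∀ a b → Partition {a + b} (λ _ → ⊤) (λ _ → ⊤)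
sides a b = record
  { #L = a ; #R = b
  ; classify = splitAt a ; element = join a b
  ; classify-element = splitAt-join a b ; element-classify = join-splitAt a b
  ; element-L = λ _ → tt ; element-R = λ _ → tt
  }

data Model {n} (G : Adj n) : Set where
  Kbip-model : ∀ a b → G ≅ Kbip a b → Model G
  K+Kbar-model : ∀ a b → 2 ≤ b → G ≅ (K a +ᴳ Kbar b) → Model G
  K+[K∪K₁]-model : ∀ a b → 2 ≤ b → G ≅ (K a +ᴳ (K b ∪ᴳ K 1)) → Model G

two-indices : ∀ {b} (j k : Fin b) → j ≢ k → 2 ≤ b
two-indices {suc zero} 0F 0F j≢k = contradiction refl j≢k
two-indices {suc (suc b)} _ _ _ = s≤s (s≤s z≤n)

module _ {n} {G : Adj n} (simple : IsSimple G) where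

  private
    sym-G = proj₁ simple
    irrefl-G = proj₂ simple

  split-by : (P : Fin n → Bool) → Partition (λ u → P u ≡ true) (λ u → P u ≢ true)
  split-by P = partition (λ u → P u ≟ᵇ true)

  right-false : ∀ {P : Fin n → Bool} j → P (element (split-by P) (inj₂ j)) ≡ false
  right-false {P} j = ¬-not (element-R (split-by P) j)

  two-right : ∀ {P : Fin n → Bool} {v₁ v₂} → v₁ ≢ v₂ → P v₁ ≡ false → P v₂ ≡ false → 2 ≤ #R (split-by P)
  two-right {P} v₁≢v₂ P₁ P₂ with locateʳ (split-by P) (λ P₁≡t → true≢false (sym P₁≡t ⨾ P₁))
                               | locateʳ (split-by P) (λ P₂≡t → true≢false (sym P₂≡t ⨾ P₂))
  ... | j₁ , e₁ | j₂ , e₂ = two-indices j₁ j₂ (λ { refl → v₁≢v₂ (sym e₁ ⨾ e₂) })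

  clique-block : ∀ {a} (inject : Fin a → Fin n) →
    (∀ {i j} → inject i ≡ inject j → i ≡ j) → (∀ i j → i ≢ j → G (inject i) (inject j) ≡ true) →
    ∀ i j → G (inject i) (inject j) ≡ K a i j
  clique-block inject injective adjacent i j with i ≟ j
  ... | yes refl = irrefl-G (inject i)
  ... | no i≢j = adjacent i j i≢j

  -- Split off the marked clique, then split the rest into c and the others.
  K+[K∪K₁]-shape⇒Model : (P : Fin n → Bool) (c : Fin n) → P c ≡ false →
    (∀ u v → u ≢ v → u ≢ c → v ≢ c → G u v ≡ true) →
    (∀ u → P u ≡ true → G u c ≡ true) → (∀ u → P u ≡ false → G u c ≡ false) →
    (∃₂ λ v₁ v₂ → v₁ ≢ v₂ × P v₁ ≡ false × P v₂ ≡ false × v₁ ≢ c × v₂ ≢ c) → Model G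
  K+[K∪K₁]-shape⇒Model P c Pc clique to-c ¬to-c (v₁ , v₂ , v₁≢v₂ , P₁ , P₂ , v₁≢c , v₂≢c) =
    K+[K∪K₁]-model (#L π) (#L ρ) 2≤B (subst (λ e → G ≅ (K (#L π) +ᴳ (K (#L ρ) ∪ᴳ K e))) E≡1 outer)
    where
    π = split-by P
    rest : Fin (#R π) → Fin n
    rest j = element π (inj₂ j)
    ρ : Partition (λ j → rest j ≢ c) (λ j → rest j ≡ c)
    ρ = Partition-swap (partition (λ j → rest j ≟ c))
    B = #L ρ
    E = #R ρ
    P-true⇒≢c : ∀ {u} → P u ≡ true → u ≢ c
    P-true⇒≢c Pu refl = true≢false (sym Pu ⨾ Pc)
    rest-injective : ∀ {i j} → rest i ≡ rest j → i ≡ j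
    rest-injective e = element-injectiveʳ π e
    unique-c : ∀ {i j} → rest i ≡ c → rest j ≡ c → i ≡ j
    unique-c eᵢ eⱼ = rest-injective (eᵢ ⨾ sym eⱼ)
    E≡1 : E ≡ 1
    E≡1 with locateʳ π (λ Pc≡true → true≢false (sym Pc≡true ⨾ Pc))
    ... | j , rest-j≡c = #R≡1 ρ unique-c (λ rest-j≢c → rest-j≢c rest-j≡c)
    2≤B : 2 ≤ B
    2≤B with locateʳ π (λ e → true≢false (sym e ⨾ P₁)) | locateʳ π (λ e → true≢false (sym e ⨾ P₂))
    ... | j₁ , e₁ | j₂ , e₂ with locateˡ ρ (λ r → v₁≢c (sym e₁ ⨾ r)) | locateˡ ρ (λ r → v₂≢c (sym e₂ ⨾ r))
    ...   | i₁ , f₁ | i₂ , f₂ = two-indices i₁ i₂ λ { refl → v₁≢v₂ (sym e₁ ⨾ cong rest (sym f₁ ⨾ f₂) ⨾ e₂) }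
    inner : (λ i j → G (rest i) (rest j)) ≅ (K B ∪ᴳ K E)
    inner = ≅-combine ρ false (K B) (K E)
      (clique-block (λ i → rest (element ρ (inj₁ i))) (λ e → element-injectiveˡ ρ (rest-injective e))
        (λ i j i≢j → clique _ _ (λ e → i≢j (element-injectiveˡ ρ (rest-injective e)))
                       (element-L ρ i) (element-L ρ j)))
      (λ i j → cong (G _) (element-R ρ j) ⨾ ¬to-c _ (right-false {P} _))
      (λ j i → sym-G _ _ ⨾ cong (G _) (element-R ρ j) ⨾ ¬to-c _ (right-false {P} _))
      (λ i j → cong₂ G (element-R ρ i) (element-R ρ j) ⨾ irrefl-G c
               ⨾ sym (subst (λ k → K E i k ≡ false) (element-injectiveʳ ρ (unique-c (element-R ρ i) (element-R ρ j)))
                        (K-irrefl i)))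
    g = proj₁ inner
    outer : G ≅ (K (#L π) +ᴳ (K B ∪ᴳ K E))
    outer = ≅-combine (Partition-reindexʳ π g) true (K (#L π)) (K B ∪ᴳ K E)
      (clique-block (λ i → element π (inj₁ i)) (element-injectiveˡ π)
        (λ i j i≢j → clique _ _ (λ e → i≢j (element-injectiveˡ π e))
                       (P-true⇒≢c (element-L π i)) (P-true⇒≢c (element-L π j))))
      marked-to-rest
      (λ k i → sym-G _ _ ⨾ marked-to-rest i k)
      (λ k k′ → proj₂ inner (from g k) (from g k′)
                ⨾ cong₂ (K B ∪ᴳ K E) (strictlyInverseˡ g k) (strictlyInverseˡ g k′))
      where
      marked-to-rest : ∀ i k → G (element π (inj₁ i)) (rest (from g k)) ≡ true
      marked-to-rest i k with rest (from g k) ≟ c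
      ... | yes e = cong (G _) e ⨾ to-c _ (element-L π i)
      ... | no r≢c = clique _ _ (λ e → true≢false (sym (element-L π i) ⨾ cong P e ⨾ right-false {P} _))
                       (P-true⇒≢c (element-L π i)) r≢c

  Shape⇒Model : Shape G → Model G
  Shape⇒Model (Kbip-shape P same different) =
    Kbip-model (#L π) (#R π) (≅-combine π true (Kbar _) (Kbar _)
      (λ i j → same _ _ (element-L π i ⨾ sym (element-L π j)))
      (λ i j → different _ _ (λ e → true≢false (sym (element-L π i) ⨾ e ⨾ right-false j)))
      (λ j i → different _ _ (λ e → true≢false (sym (element-L π i) ⨾ sym e ⨾ right-false j)))
      (λ i j → same _ _ (right-false i ⨾ sym (right-false j))))
    where π = split-by P
  Shape⇒Model (K+Kbar-shape P universal independent (v₁ , v₂ , v₁≢v₂ , P₁ , P₂)) =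
    K+Kbar-model (#L π) (#R π) (two-right v₁≢v₂ P₁ P₂) (≅-combine π true (K _) (Kbar _)
      (clique-block (λ i → element π (inj₁ i)) (element-injectiveˡ π)
        (λ i j i≢j → universal _ _ (λ e → i≢j (element-injectiveˡ π e)) (element-L π i)))
      (λ i j → universal _ _ (λ e → true≢false (sym (element-L π i) ⨾ cong P e ⨾ right-false j)) (element-L π i))
      (λ j i → sym-G _ _ ⨾ universal _ _ (λ e → true≢false (sym (element-L π i) ⨾ cong P e ⨾ right-false j)) (element-L π i))
      (λ i j → independent _ _ (right-false i) (right-false j)))
    where π = split-by P
  Shape⇒Model (K+[K∪K₁]-shape P c Pc clique to-c ¬to-c two) = K+[K∪K₁]-shape⇒Model P c Pc clique to-c ¬to-c two

-- The six families

Kbip-comm : ∀ a b → Kbip a b ≅ Kbip b a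
Kbip-comm a b = ≅-combine (Partition-swap (sides a b)) true (Kbar b) (Kbar a)
  (combine-ʳʳ true (Kbar a) (Kbar b)) (combine-ʳˡ true (Kbar a) (Kbar b))
  (λ j i → combine-ˡʳ true (Kbar a) (Kbar b) j i) (combine-ˡˡ true (Kbar a) (Kbar b))

K₁∪K₁≗Kbar₂ : ∀ (i j : Fin 2) → (K 1 ∪ᴳ K 1) i j ≡ Kbar 2 i j
K₁∪K₁≗Kbar₂ 0F 0F = refl
K₁∪K₁≗Kbar₂ 0F (1+ 0F) = refl
K₁∪K₁≗Kbar₂ (1+ 0F) 0F = refl
K₁∪K₁≗Kbar₂ (1+ 0F) (1+ 0F) = refl

K+[K₁∪K₁]≅K+Kbar₂ : ∀ a → (K a +ᴳ (K 1 ∪ᴳ K 1)) ≅ (K a +ᴳ Kbar 2)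
K+[K₁∪K₁]≅K+Kbar₂ a = ≅-combine (sides a 2) true (K a) (Kbar 2)
  (combine-ˡˡ true (K a) (K 1 ∪ᴳ K 1)) (combine-ˡʳ true (K a) (K 1 ∪ᴳ K 1))
  (combine-ʳˡ true (K a) (K 1 ∪ᴳ K 1))
  (λ i j → combine-ʳʳ true (K a) (K 1 ∪ᴳ K 1) i j ⨾ K₁∪K₁≗Kbar₂ i j)

K+[K₀∪K₁]-complete : ∀ a u v → u ≢ v → (K a +ᴳ (K 0 ∪ᴳ K 1)) u v ≡ true
K+[K₀∪K₁]-complete a u v u≢v with side₃ a 0 u | side₃ a 0 v
... | inA i | inA j = combine-ˡˡ true (K a) (K 0 ∪ᴳ K 1) i j ⨾ K-adjacent (λ i≡j → u≢v (cong (_↑ˡ 1) i≡j))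
... | inA i | isC = combine-ˡʳ true (K a) (K 0 ∪ᴳ K 1) i _
... | isC | inA j = combine-ʳˡ true (K a) (K 0 ∪ᴳ K 1) _ j
... | isC | isC = contradiction refl u≢v

∸-cancelˡ : ∀ x y ℓ → 1 ≤ x → (x + y) ∸ ℓ ≡ x → ℓ ≡ y
∸-cancelˡ x y ℓ 1≤x eq with ℓ ≤? x + y
... | yes ℓ≤ = +-cancelˡ-≡ x ℓ y (cong (_+ ℓ) (sym eq) ⨾ m∸n+n≡m ℓ≤)
... | no ℓ≰ = contradiction (sym eq ⨾ m≤n⇒m∸n≡0 (<⇒≤ (≰⇒> ℓ≰))) (λ x≡0 → contradiction (subst (1 ≤_) x≡0 1≤x) λ ())

module _ {n} {G : Adj n} (ℓ : ℕ) where

  pin-ℓ : ∀ {k} {H : Adj k} {m y} → DistNum G (n ∸ ℓ) → G ≅ H → DistNum H m → 1 ≤ m → k ≡ m + y → ℓ ≡ y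
  pin-ℓ {H = H} {m} {y} D iso DH 1≤m k≡ =
    ∸-cancelˡ m y ℓ 1≤m (cong (_∸ ℓ) (sym (≅⇒≡ {H = H} iso ⨾ k≡)) ⨾ DistNum-functional D (DistNum-transport iso DH))

  DistNum-via : ∀ {k} {H : Adj k} {m} → G ≅ H → DistNum H m → k ≡ m + ℓ → DistNum G (n ∸ ℓ)
  DistNum-via {H = H} {m} iso DH k≡ =
    subst (DistNum G) (sym (cong (_∸ ℓ) (≅⇒≡ {H = H} iso ⨾ k≡) ⨾ m+n∸n≡m m ℓ)) (DistNum-transport iso DH)

  module _ (4≤n : 4 ≤ n) (D : DistNum G (n ∸ ℓ)) where

    private
      Kbip-unbalanced : ∀ a b → b < a → G ≅ Kbip a b → Family ℓ G
      Kbip-unbalanced a b b<a iso with pin-ℓ D iso (DistNum-Kbip-< b<a) (≤-trans (s≤s z≤n) b<a) refl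
      ... | refl = inj₂ (inj₁ (a , b<a , iso))

      Kbip-balanced : ∀ a → G ≅ Kbip a a → Family ℓ G
      Kbip-balanced zero iso with ≅⇒≡ {H = Kbip 0 0} iso
      ... | refl = contradiction 4≤n λ ()
      Kbip-balanced (suc a) iso with pin-ℓ D iso (DistNum-Kbip-≡ a) (s≤s z≤n) (cong suc (+-suc a a))
      ... | refl = inj₁ iso

    Model⇒Family : Model G → Family ℓ G
    Model⇒Family (Kbip-model a b iso) with <-cmp a b
    ... | tri< a<b _ _ = Kbip-unbalanced b a a<b (≅-trans {H = Kbip a b} {J = Kbip b a} iso (Kbip-comm a b))
    ... | tri≈ _ refl _ = Kbip-balanced a iso
    ... | tri> _ _ b<a = Kbip-unbalanced a b b<a iso
    Model⇒Family (K+Kbar-model a b 2≤b iso) with ≤-total a b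
    ... | inj₁ a≤b with pin-ℓ D iso (DistNum-K+Kbar-≤ a≤b 2≤b) (≤-trans (s≤s z≤n) 2≤b) (+-comm a b)
    ...   | refl = inj₂ (inj₂ (inj₁ (b , a≤b , iso)))
    Model⇒Family (K+Kbar-model a b 2≤b iso) | inj₂ b≤a
      with pin-ℓ D iso (DistNum-K+Kbar-≥ b≤a 2≤b) (≤-trans (s≤s z≤n) (≤-trans 2≤b b≤a)) refl
    ... | refl = inj₂ (inj₂ (inj₂ (inj₁ (a , b≤a , 2≤b , iso))))
    Model⇒Family (K+[K∪K₁]-model a b 2≤b iso) with ≤-total a b
    ... | inj₁ a≤b with pin-ℓ D iso (DistNum-K+[K∪K₁]-≤ a≤b 2≤b) (≤-trans (s≤s z≤n) 2≤b)
                          (cong (a +_) (+-comm b 1) ⨾ +-comm a (suc b) ⨾ sym (+-suc b a))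
    ...   | refl = inj₂ (inj₂ (inj₂ (inj₂ (inj₁ (b , 2≤b , a≤b , iso)))))
    Model⇒Family (K+[K∪K₁]-model a b 2≤b iso) | inj₂ b≤a
      with pin-ℓ D iso (DistNum-K+[K∪K₁]-≥ b≤a 2≤b) (≤-trans (s≤s z≤n) (≤-trans 2≤b b≤a)) (cong (a +_) (+-comm b 1))
    ... | refl = inj₂ (inj₂ (inj₂ (inj₂ (inj₂ (a , ≤-trans 2≤b b≤a , b≤a , iso)))))

K+Kbar-larger-side : ∀ {n ℓ t} {G : Adj n} → 4 ≤ n → ℓ ≤ t → G ≅ (K ℓ +ᴳ Kbar t) → 2 ≤ t
K+Kbar-larger-side {t = zero} 4≤n z≤n iso with ≅⇒≡ {H = K 0 +ᴳ Kbar 0} iso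
... | refl = contradiction 4≤n λ ()
K+Kbar-larger-side {ℓ = zero} {suc zero} 4≤n z≤n iso with ≅⇒≡ {H = K 0 +ᴳ Kbar 1} iso
... | refl = contradiction 4≤n λ { (s≤s ()) }
K+Kbar-larger-side {ℓ = suc zero} {suc zero} 4≤n (s≤s z≤n) iso with ≅⇒≡ {H = K 1 +ᴳ Kbar 1} iso
... | refl = contradiction 4≤n λ { (s≤s (s≤s ())) }
K+Kbar-larger-side {ℓ = suc (suc _)} {suc zero} _ (s≤s ()) _
K+Kbar-larger-side {t = suc (suc t)} _ _ _ = s≤s (s≤s z≤n)

Family⇒DistNum : ∀ {n} {G : Adj n} → IsSimple G → Connected G → 4 ≤ n → MetricDim G (n ∸ 2) →
  ∀ ℓ → 1 ≤ ℓ → Family ℓ G → DistNum G (n ∸ ℓ)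
Family⇒DistNum _ _ _ _ ℓ _ (inj₁ iso) = DistNum-via ℓ iso (DistNum-Kbip-≡ ℓ) (cong suc (+-suc ℓ ℓ))
Family⇒DistNum _ _ _ _ ℓ _ (inj₂ (inj₁ (t , ℓ<t , iso))) = DistNum-via ℓ iso (DistNum-Kbip-< ℓ<t) refl
Family⇒DistNum _ _ 4≤n _ ℓ _ (inj₂ (inj₂ (inj₁ (t , ℓ≤t , iso)))) =
  DistNum-via ℓ iso (DistNum-K+Kbar-≤ ℓ≤t (K+Kbar-larger-side 4≤n ℓ≤t iso)) (+-comm ℓ t)
Family⇒DistNum _ _ _ _ ℓ _ (inj₂ (inj₂ (inj₂ (inj₁ (t , ℓ≤t , 2≤ℓ , iso))))) =
  DistNum-via ℓ iso (DistNum-K+Kbar-≥ ℓ≤t 2≤ℓ) refl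
Family⇒DistNum _ _ _ _ (suc ℓ) _ (inj₂ (inj₂ (inj₂ (inj₂ (inj₁ (t , 2≤t , ℓ≤t , iso)))))) =
  DistNum-via (suc ℓ) iso (DistNum-K+[K∪K₁]-≤ ℓ≤t 2≤t) (+-comm ℓ (t + 1) ⨾ +-assoc t 1 ℓ)
Family⇒DistNum simple connected 4≤n dim 1 _ (inj₂ (inj₂ (inj₂ (inj₂ (inj₂ (t , _ , _ , f , adj)))))) with not-complete
  where open DimensionNMinusTwo simple connected 4≤n dim
... | u , v , u≢v , ¬uv =
  ⊥-elim (true≢false (sym (adj u v ⨾ K+[K₀∪K₁]-complete t _ _ (λ e → u≢v (to-injective f e))) ⨾ ¬uv))
Family⇒DistNum _ _ _ _ 2 _ (inj₂ (inj₂ (inj₂ (inj₂ (inj₂ (t , 2≤t , _ , iso)))))) =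
  DistNum-via 2 (≅-trans {H = K t +ᴳ (K 1 ∪ᴳ K 1)} {J = K t +ᴳ Kbar 2} iso (K+[K₁∪K₁]≅K+Kbar₂ t))
    (DistNum-K+Kbar-≥ 2≤t (s≤s (s≤s z≤n))) refl
Family⇒DistNum _ _ _ _ (suc (suc (suc ℓ))) _ (inj₂ (inj₂ (inj₂ (inj₂ (inj₂ (t , _ , ℓ≤t , iso)))))) =
  DistNum-via (3 + ℓ) iso (DistNum-K+[K∪K₁]-≥ ℓ≤t (s≤s (s≤s z≤n))) (cong (t +_) (+-comm (2 + ℓ) 1))

mainTheorem7 : ∀ {n} (G : Adj n) → IsSimple G → Connected G → 4 ≤ n →
    MetricDim G (n ∸ 2) → ∀ (ℓ : ℕ) → 1 ≤ ℓ →
    DistNum G (n ∸ ℓ) ⇔ Family ℓ G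
mainTheorem7 G simple connected 4≤n dim ℓ 1≤ℓ =
  mk⇔ (λ D → Model⇒Family ℓ 4≤n D (Shape⇒Model simple structure))
      (Family⇒DistNum simple connected 4≤n dim ℓ 1≤ℓ)
  where open DimensionNMinusTwo simple connected 4≤n dim using (structure)
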